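{- Let $k\ge 3$ and let $\mathcal P_k$ be the path with vertices $1,\dots,k$. Let $1\le i<j\le k$ with $j-i\ge 2$, and let $\mathcal P_k^{\{i,j\}}$ be the graph obtained from $\mathcal P_k$ by adding the edge $\{i,j\}$. If $i\le\lceil k/2\rceil<j$, then $\kappa(\mathcal P_k^{\{i,j\}})-\kappa(\mathcal P_k)<0$.
   Context: For a connected graph $G$, $\kappa(G)$ denotes Kemeny's constant of the simple random walk on $G$: $\kappa(G)=\sum_{j\neq i} m_{ij}\pi_j$, where $m_{ij}$ is the mean first passage time from $i$ to $j$ and $\pi$ is the stationary distribution; this is independent of $i$. -}

module Defs where

open import Data.Bool using (Bool; true; false; if_then_else_; _∨_; _∧_)
open import Data.Nat as ℕ using (ℕ; zero; suc; _≡ᵇ_)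
open import Data.Fin using (Fin; toℕ)
open import Data.Fin.Properties using (_≟_)
open import Data.Integer using (+_)
open import Data.Rational using (ℚ; 0ℚ; 1ℚ; _+_; _*_; _/_; _≤_)
open import Data.Product using (Σ; _×_; ∃)
open import Relation.Nullary.Decidable using (⌊_⌋)
open import Relation.Binary.PropositionalEquality using (_≡_)

Graph : ℕ → Set
Graph n = Fin n → Fin n → Bool

ΣF : ∀ {n} → (Fin n → ℚ) → ℚ
ΣF {zero}  f = 0ℚ
ΣF {suc n} f = f Data.Fin.zero + ΣF (λ x → f (Data.Fin.suc x))

Σℕ : ∀ {n} → (Fin n → ℕ) → ℕ
Σℕ {zero}  f = 0
Σℕ {suc n} f = f Data.Fin.zero ℕ.+ Σℕ (λ x → f (Data.Fin.suc x))

degree : ∀ {n} → Graph n → Fin n → ℕ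
degree G u = Σℕ (λ v → if G u v then 1 else 0)

-- 1/d as a rational (only used for d ≥ 1; value 0 for d = 0 is irrelevant
-- since then there are no neighbours).
inv : ℕ → ℚ
inv zero    = 0ℚ
inv (suc d) = + 1 / suc d

P : ∀ {n} → Graph n → Fin n → Fin n → ℚ
P G u v = if G u v then inv (degree G u) else 0ℚ

IsStationary : ∀ {n} → Graph n → (Fin n → ℚ) → Set
IsStationary G π =
  (∀ u → 0ℚ ≤ π u) × (ΣF π ≡ 1ℚ) × (∀ v → ΣF (λ u → π u * P G u v) ≡ π v)

-- m is the matrix of mean first passage times (m i j = expected time to
-- reach j from i; for i = j the mean return time), characterised as the
-- (unique, for connected G) solution of the first-step equations
--   m i j = 1 + Σ_{l ≠ j} P i l * m l j.
IsMFPT : ∀ {n} → Graph n → (Fin n → Fin n → ℚ) → Set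
IsMFPT G m =
  ∀ i j → m i j ≡ 1ℚ + ΣF (λ l → if ⌊ l ≟ j ⌋ then 0ℚ else P G i l * m l j)

IsKemeny : ∀ {n} → Graph n → ℚ → Set
IsKemeny {n} G κ =
  Σ (Fin n → ℚ) λ π → Σ (Fin n → Fin n → ℚ) λ m →
    IsStationary G π × IsMFPT G m ×
    (∀ i → κ ≡ ΣF (λ j → if ⌊ j ≟ i ⌋ then 0ℚ else m i j * π j))

-- The path P_k on vertices 1..k (vertex v : Fin k has label toℕ v + 1).
path : (k : ℕ) → Graph k
path k u v = (suc (toℕ u) ≡ᵇ toℕ v) ∨ (suc (toℕ v) ≡ᵇ toℕ u)

-- G with the edge {i, j} added (i, j are labels in 1..k).
addEdge : ∀ {k} → ℕ → ℕ → Graph k → Graph k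
addEdge i j G u v =
  G u v ∨ (((suc (toℕ u) ≡ᵇ i) ∧ (suc (toℕ v) ≡ᵇ j)) ∨ ((suc (toℕ u) ≡ᵇ j) ∧ (suc (toℕ v) ≡ᵇ i)))

{-# OPTIONS --safe #-}
module Submission where

-- Number the vertices 0, …, k-1, so that the chord joins A = i-1 and B = j-1 and closes a cycle of
-- length c = B - A + 1, and compute both Kemeny constants as Σₜ πₜ m(0, t).  Stationarity forces π to be
-- proportional to the degree.  For the hitting times h = m(·, t) of a target t, summing the first-step
-- equations over the vertices 0, …, p says that the flux of h across the cut after p is the volume of
-- {0, …, p}, less the whole volume once the cut has passed t.  On the path this fixes every drop
-- h p - h (p+1), giving m(0, t) = t² and κ(Pₖ) = (2k² - 4k + 3)/6.  With the chord, part of the flux,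
-- h A - h B, runs along the chord; the drops around the cycle add up to the same amount, which determines
-- c (h A - h B), and then c m(0, t) is an explicit quadratic in t on each of the ranges t ≤ A, A < t < B
-- and B ≤ t.  Summing, with a = A and b = k-1-B,
--   12 k c (κ(Pₖ) - κ(Pₖ^{ij})) = 2c²(c-2)² + 8c((a+b)(c-1)(c-2) + a(c-1+b-a) + b(c-1+a-b))
--                                 + 8ab(3c² - 7c + 3),
-- and i ≤ ⌈k/2⌉ < j gives |a - b| < c, so every term is non-negative and the first one is positive.

open import Defs

module KemenyConstants where

  open import Agda.Builtin.FromNat using (Number; fromNat)
  open import Data.Bool using (Bool; true; false; if_then_else_; _∨_; _∧_)
  import Data.Bool.Properties as Bool
  open import Data.Empty using (⊥-elim)
  open import Data.Fin as Fin using (Fin; toℕ; fromℕ<)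
  import Data.Fin.Properties as Fin
  import Data.Integer as ℤ
  import Data.Integer.Properties as ℤ
  open import Data.Maybe using (Maybe; just; nothing)
  open import Data.Nat as ℕ using (ℕ; zero; suc; _≡ᵇ_; _<ᵇ_; z≤n; s≤s; ⌈_/2⌉)
  import Data.Nat.Literals as ℕ
  import Data.Nat.Properties as ℕ
  open import Data.Nat.Coprimality using (1-coprimeTo) renaming (sym to coprime-sym)
  open import Data.Product using (∃; _×_; _,_; proj₁; proj₂)
  open import Data.Rational
    using (ℚ; 0ℚ; 1ℚ; _+_; _*_; _-_; -_; _/_; mkℚ; ½; _≤_; _<_; positive; nonNegative)
  import Data.Rational.Literals as ℚ
  open import Data.Rational.Properties
  open import Data.Unit using (tt)
  open import Function.Bundles using (Equivalence)
  open import Level using (0ℓ)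
  open import Relation.Binary.PropositionalEquality
  open import Relation.Nullary using (yes; no)
  open import Relation.Nullary.Decidable using (⌊_⌋)
  open import Tactic.RingSolver using (solve-∀)
  import Tactic.RingSolver.Core.AlmostCommutativeRing as ACR

  -- Arithmetic

  instance
    ℕ-number : Number ℕ
    ℕ-number = ℕ.number
    ℚ-number : Number ℚ
    ℚ-number = ℚ.number

  ringℚ : ACR.AlmostCommutativeRing 0ℓ 0ℓ
  ringℚ = ACR.fromCommutativeRing +-*-commutativeRing is-zero
    where
    is-zero : ∀ x → Maybe (0ℚ ≡ x)
    is-zero x with 0ℚ ≟ x
    ... | yes p = just p
    ... | no _  = nothing

  -- Unlike ℤ.+ n / 1, this embedding computes on suc, so ⟦ suc (suc e) ⟧ is 1ℚ + (1ℚ + ⟦ e ⟧).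
  ⟦_⟧ : ℕ → ℚ
  ⟦ zero ⟧  = 0ℚ
  ⟦ suc n ⟧ = 1ℚ + ⟦ n ⟧

  ⟦⟧-+ : ∀ m n → ⟦ m ℕ.+ n ⟧ ≡ ⟦ m ⟧ + ⟦ n ⟧
  ⟦⟧-+ zero    n = sym (+-identityˡ ⟦ n ⟧)
  ⟦⟧-+ (suc m) n = trans (cong (1ℚ +_) (⟦⟧-+ m n)) (sym (+-assoc 1ℚ ⟦ m ⟧ ⟦ n ⟧))

  ⟦⟧-∸ : ∀ {m n} → n ℕ.≤ m → ⟦ m ℕ.∸ n ⟧ ≡ ⟦ m ⟧ - ⟦ n ⟧
  ⟦⟧-∸ {m} {n} n≤m =
    trans (difference ⟦ n ⟧ ⟦ m ℕ.∸ n ⟧)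
          (cong (_- ⟦ n ⟧) (trans (sym (⟦⟧-+ n (m ℕ.∸ n))) (cong ⟦_⟧ (ℕ.m+[n∸m]≡n n≤m))))
    where
    difference : ∀ x y → y ≡ (x + y) - x
    difference = solve-∀ ringℚ

  ⟦⟧≡mkℚ : ∀ n → ⟦ n ⟧ ≡ mkℚ (ℤ.+ n) 0 (coprime-sym (1-coprimeTo n))
  ⟦⟧≡mkℚ zero    = refl
  ⟦⟧≡mkℚ (suc n) = begin
    1ℚ + ⟦ n ⟧                        ≡⟨ cong (1ℚ +_) (⟦⟧≡mkℚ n) ⟩
    (ℤ.+ 1 ℤ.+ ℤ.+ n ℤ.* ℤ.+ 1) / 1   ≡⟨ cong (λ z → (ℤ.+ 1 ℤ.+ z) / 1) (ℤ.*-identityʳ (ℤ.+ n)) ⟩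
    ℤ.+ suc n / 1                     ≡⟨ ↥p/↧p≡p (mkℚ (ℤ.+ suc n) 0 _) ⟩
    mkℚ (ℤ.+ suc n) 0 _               ∎
    where open ≡-Reasoning

  0≤⟦_⟧ : ∀ n → 0ℚ ≤ ⟦ n ⟧
  0≤⟦ n ⟧ rewrite ⟦⟧≡mkℚ n = nonNegative⁻¹ _

  ⟦suc⟧*inv : ∀ d → ⟦ suc d ⟧ * inv (suc d) ≡ 1ℚ
  ⟦suc⟧*inv d = begin
    ⟦ suc d ⟧ * inv (suc d)
      ≡⟨ cong₂ _*_ (⟦⟧≡mkℚ (suc d)) (↥p/↧p≡p (mkℚ (ℤ.+ 1) d (1-coprimeTo (suc d)))) ⟩
    mkℚ (ℤ.+ suc d) 0 (coprime-sym (1-coprimeTo (suc d))) * mkℚ (ℤ.+ 1) d (1-coprimeTo (suc d))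
      ≡⟨ *-inverseʳ (mkℚ (ℤ.+ suc d) 0 (coprime-sym (1-coprimeTo (suc d)))) ⟩
    1ℚ ∎
    where open ≡-Reasoning

  ⟦⟧*inv : ∀ n → n ≢ 0 → ⟦ n ⟧ * inv n ≡ 1ℚ
  ⟦⟧*inv zero    n≢0 = ⊥-elim (n≢0 refl)
  ⟦⟧*inv (suc d) _   = ⟦suc⟧*inv d

  ⟦suc⟧*x≡0⇒x≡0 : ∀ n x → ⟦ suc n ⟧ * x ≡ 0ℚ → x ≡ 0ℚ
  ⟦suc⟧*x≡0⇒x≡0 n x nx≡0 = begin
    x                                ≡⟨ sym (*-identityˡ x) ⟩
    1ℚ * x                           ≡⟨ cong (_* x) (sym (⟦suc⟧*inv n)) ⟩
    (⟦ suc n ⟧ * inv (suc n)) * x    ≡⟨ rearrange ⟦ suc n ⟧ (inv (suc n)) x ⟩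
    inv (suc n) * (⟦ suc n ⟧ * x)    ≡⟨ cong (inv (suc n) *_) nx≡0 ⟩
    inv (suc n) * 0ℚ                 ≡⟨ *-zeroʳ (inv (suc n)) ⟩
    0ℚ                               ∎
    where
    open ≡-Reasoning
    rearrange : ∀ a b c → (a * b) * c ≡ b * (a * c)
    rearrange = solve-∀ ringℚ

  move-right : ∀ d y r → d + y ≡ r → d ≡ r - y
  move-right d y r d+y≡r = trans (restore d y) (cong (_- y) d+y≡r)
    where
    restore : ∀ d y → d ≡ (d + y) - y
    restore = solve-∀ ringℚ

  0≤+ : ∀ {p q} → 0ℚ ≤ p → 0ℚ ≤ q → 0ℚ ≤ p + q
  0≤+ = +-mono-≤

  0<+ : ∀ {p q} → 0ℚ < p → 0ℚ ≤ q → 0ℚ < p + q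
  0<+ = +-mono-<-≤

  0≤* : ∀ {p q} → 0ℚ ≤ p → 0ℚ ≤ q → 0ℚ ≤ p * q
  0≤* {p} {q} 0≤p 0≤q =
    nonNegative⁻¹ (p * q) {{nonNeg*nonNeg⇒nonNeg p {{nonNegative 0≤p}} q {{nonNegative 0≤q}}}}

  0<* : ∀ {p q} → 0ℚ < p → 0ℚ < q → 0ℚ < p * q
  0<* {p} {q} 0<p 0<q = positive⁻¹ (p * q) {{pos*pos⇒pos p {{positive 0<p}} q {{positive 0<q}}}}

  𝟙 : Bool → ℚ
  𝟙 true  = 1ℚ
  𝟙 false = 0ℚ

  ≡ᵇ-refl : ∀ n → (n ≡ᵇ n) ≡ true
  ≡ᵇ-refl zero    = refl
  ≡ᵇ-refl (suc n) = ≡ᵇ-refl n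

  ≡ᵇ-sym : ∀ m n → (m ≡ᵇ n) ≡ (n ≡ᵇ m)
  ≡ᵇ-sym zero    zero    = refl
  ≡ᵇ-sym zero    (suc n) = refl
  ≡ᵇ-sym (suc m) zero    = refl
  ≡ᵇ-sym (suc m) (suc n) = ≡ᵇ-sym m n

  ≡ᵇ-false : ∀ {m n} → m ≢ n → (m ≡ᵇ n) ≡ false
  ≡ᵇ-false {zero}  {zero}  m≢n = ⊥-elim (m≢n refl)
  ≡ᵇ-false {zero}  {suc n} _   = refl
  ≡ᵇ-false {suc m} {zero}  _   = refl
  ≡ᵇ-false {suc m} {suc n} m≢n = ≡ᵇ-false (λ m≡n → m≢n (cong suc m≡n))

  ≡ᵇ-true⇒≡ : ∀ {m n} → (m ≡ᵇ n) ≡ true → m ≡ n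
  ≡ᵇ-true⇒≡ {m} {n} eq = ℕ.≡ᵇ⇒≡ m n (Equivalence.from Bool.T-≡ eq)

  <ᵇ-true : ∀ {m n} → m ℕ.< n → (m <ᵇ n) ≡ true
  <ᵇ-true m<n = Equivalence.to Bool.T-≡ (ℕ.<⇒<ᵇ m<n)

  <ᵇ-false : ∀ {m n} → n ℕ.≤ m → (m <ᵇ n) ≡ false
  <ᵇ-false {m} {n} n≤m with m <ᵇ n in eq
  ... | true  = ⊥-elim (ℕ.≤⇒≯ n≤m (ℕ.<ᵇ⇒< m n (Equivalence.from Bool.T-≡ eq)))
  ... | false = refl

  𝟙-∨ : ∀ a b → (b ≡ true → a ≡ false) → 𝟙 (a ∨ b) ≡ 𝟙 a + 𝟙 b
  𝟙-∨ true  true  exclusive with () ← exclusive refl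
  𝟙-∨ true  false _ = sym (+-identityʳ 1ℚ)
  𝟙-∨ false b     _ = sym (+-identityˡ (𝟙 b))

  𝟙-∧ : ∀ a b → 𝟙 (a ∧ b) ≡ 𝟙 a * 𝟙 b
  𝟙-∧ true  b = sym (*-identityˡ (𝟙 b))
  𝟙-∧ false b = sym (*-zeroˡ (𝟙 b))

  -- Finite sums

  ∑ : ℕ → (ℕ → ℚ) → ℚ
  ∑ zero    f = 0ℚ
  ∑ (suc n) f = f 0 + ∑ n (λ q → f (suc q))

  ∑-cong : ∀ n {f g : ℕ → ℚ} → (∀ q → q ℕ.< n → f q ≡ g q) → ∑ n f ≡ ∑ n g
  ∑-cong zero    f≡g = refl
  ∑-cong (suc n) f≡g = cong₂ _+_ (f≡g 0 (s≤s z≤n)) (∑-cong n (λ q q<n → f≡g (suc q) (s≤s q<n)))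

  ∑-0 : ∀ n → ∑ n (λ _ → 0ℚ) ≡ 0ℚ
  ∑-0 zero    = refl
  ∑-0 (suc n) = trans (+-identityˡ _) (∑-0 n)

  ∑-0* : ∀ n (f : ℕ → ℚ) → ∑ n (λ q → 0ℚ * f q) ≡ 0ℚ
  ∑-0* zero    f = refl
  ∑-0* (suc n) f = trans (cong₂ _+_ (*-zeroˡ (f 0)) (∑-0* n (λ q → f (suc q)))) (+-identityˡ 0ℚ)

  ∑-+ : ∀ n (f g : ℕ → ℚ) → ∑ n (λ q → f q + g q) ≡ ∑ n f + ∑ n g
  ∑-+ zero    f g = refl
  ∑-+ (suc n) f g = trans (cong ((f 0 + g 0) +_) (∑-+ n _ _)) (interchange (f 0) (g 0) _ _)
    where
    interchange : ∀ a b c d → (a + b) + (c + d) ≡ (a + c) + (b + d)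
    interchange = solve-∀ ringℚ

  ∑-- : ∀ n (f g : ℕ → ℚ) → ∑ n (λ q → f q - g q) ≡ ∑ n f - ∑ n g
  ∑-- zero    f g = refl
  ∑-- (suc n) f g = trans (cong ((f 0 - g 0) +_) (∑-- n _ _)) (interchange (f 0) (g 0) _ _)
    where
    interchange : ∀ a b c d → (a - b) + (c - d) ≡ (a + c) - (b + d)
    interchange = solve-∀ ringℚ

  ∑-*ˡ : ∀ n c (f : ℕ → ℚ) → ∑ n (λ q → c * f q) ≡ c * ∑ n f
  ∑-*ˡ zero    c f = sym (*-zeroʳ c)
  ∑-*ˡ (suc n) c f = trans (cong (c * f 0 +_) (∑-*ˡ n c _)) (sym (*-distribˡ-+ c (f 0) _))

  ∑-last : ∀ n (f : ℕ → ℚ) → ∑ (suc n) f ≡ ∑ n f + f n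
  ∑-last zero    f = trans (+-identityʳ (f 0)) (sym (+-identityˡ (f 0)))
  ∑-last (suc n) f = trans (cong (f 0 +_) (∑-last n _)) (sym (+-assoc (f 0) _ _))

  ∑-split : ∀ m n (f : ℕ → ℚ) → ∑ (m ℕ.+ n) f ≡ ∑ m f + ∑ n (λ q → f (m ℕ.+ q))
  ∑-split zero    n f = sym (+-identityˡ _)
  ∑-split (suc m) n f = trans (cong (f 0 +_) (∑-split m n _)) (sym (+-assoc (f 0) _ _))

  ∑-δ : ∀ n a (f : ℕ → ℚ) → ∑ n (λ q → 𝟙 (q ≡ᵇ a) * f q) ≡ 𝟙 (a <ᵇ n) * f a
  ∑-δ zero    a       f = sym (*-zeroˡ (f a))
  ∑-δ (suc n) zero    f = trans (cong (1ℚ * f 0 +_) (∑-0* n (λ q → f (suc q)))) (+-identityʳ _)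
  ∑-δ (suc n) (suc a) f =
    trans (cong (_+ ∑ n (λ q → 𝟙 (q ≡ᵇ a) * f (suc q))) (*-zeroˡ (f 0)))
          (trans (+-identityˡ _) (∑-δ n a (λ q → f (suc q))))

  ∑-update : ∀ n t (f g : ℕ → ℚ) → (∀ q → q ℕ.< n → q ≢ t → f q ≡ g q) →
             ∑ n f ≡ ∑ n g + 𝟙 (t <ᵇ n) * (f t - g t)
  ∑-update n t f g f≡g = begin
    ∑ n f                                          ≡⟨ ∑-cong n pointwise ⟩
    ∑ n (λ q → g q + 𝟙 (q ≡ᵇ t) * (f t - g t))     ≡⟨ ∑-+ n g _ ⟩
    ∑ n g + ∑ n (λ q → 𝟙 (q ≡ᵇ t) * (f t - g t))   ≡⟨ cong (∑ n g +_) (∑-δ n t (λ _ → f t - g t)) ⟩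
    ∑ n g + 𝟙 (t <ᵇ n) * (f t - g t)               ∎
    where
    open ≡-Reasoning
    restore : ∀ a b → b ≡ a + 1ℚ * (b - a)
    restore = solve-∀ ringℚ
    pad : ∀ a b → a ≡ a + 0ℚ * b
    pad = solve-∀ ringℚ
    pointwise : ∀ q → q ℕ.< n → f q ≡ g q + 𝟙 (q ≡ᵇ t) * (f t - g t)
    pointwise q q<n with q ℕ.≟ t
    ... | yes refl rewrite ≡ᵇ-refl q = restore (g q) (f q)
    ... | no q≢t rewrite ≡ᵇ-false q≢t = trans (f≡g q q<n q≢t) (pad (g q) (f t - g t))

  ∑-telescope : ∀ n (h : ℕ → ℚ) → ∑ n (λ q → h q - h (suc q)) ≡ h 0 - h n
  ∑-telescope zero    h = sym (+-inverseʳ (h 0))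
  ∑-telescope (suc n) h = begin
    (h 0 - h 1) + ∑ n (λ q → h (suc q) - h (suc (suc q)))
      ≡⟨ cong ((h 0 - h 1) +_) (∑-telescope n (λ q → h (suc q))) ⟩
    (h 0 - h 1) + (h 1 - h (suc n))
      ≡⟨ chain (h 0) (h 1) (h (suc n)) ⟩
    h 0 - h (suc n) ∎
    where
    open ≡-Reasoning
    chain : ∀ a b c → (a - b) + (b - c) ≡ a - c
    chain = solve-∀ ringℚ

  -- INLINE lets solve-∀, which does not unfold definitions, see through these polynomials.
  quadratic : ℚ → ℚ → ℚ → ℚ → ℚ
  quadratic u v w x = u + v * x + w * (x * x)
  {-# INLINE quadratic #-}

  sixth : ℚ
  sixth = ℤ.+ 1 / 6

  ∑quadratic : ℚ → ℚ → ℚ → ℚ → ℚ → ℚ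
  ∑quadratic u v w L N =
    N * u + v * (N * L + N * (N - 1ℚ) * ½) + w * (N * L * L + L * N * (N - 1ℚ) + (N - 1ℚ) * N * (2 * N - 1ℚ) * sixth)
  {-# INLINE ∑quadratic #-}

  ∑-quadratic : ∀ n lo u v w → ∑ n (λ q → quadratic u v w ⟦ lo ℕ.+ q ⟧) ≡ ∑quadratic u v w ⟦ lo ⟧ ⟦ n ⟧
  ∑-quadratic zero    lo u v w = sym (vanishes u v w ⟦ lo ⟧)
    where
    vanishes : ∀ u v w L → ∑quadratic u v w L 0ℚ ≡ 0ℚ
    vanishes = solve-∀ ringℚ
  ∑-quadratic (suc n) lo u v w = begin
    ∑ (suc n) f
      ≡⟨ ∑-last n f ⟩
    ∑ n f + f n
      ≡⟨ cong₂ _+_ (∑-quadratic n lo u v w) (cong (quadratic u v w) (⟦⟧-+ lo n)) ⟩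
    ∑quadratic u v w ⟦ lo ⟧ ⟦ n ⟧ + quadratic u v w (⟦ lo ⟧ + ⟦ n ⟧)
      ≡⟨ step u v w ⟦ lo ⟧ ⟦ n ⟧ ⟩
    ∑quadratic u v w ⟦ lo ⟧ (1ℚ + ⟦ n ⟧) ∎
    where
    open ≡-Reasoning
    f : ℕ → ℚ
    f q = quadratic u v w ⟦ lo ℕ.+ q ⟧
    step : ∀ u v w L N → ∑quadratic u v w L N + quadratic u v w (L + N) ≡ ∑quadratic u v w L (1ℚ + N)
    step = solve-∀ ringℚ

  linear-drop : ℚ → ℚ → ℚ → ℚ → ℚ
  linear-drop u v L N = N * (u + v * L) + v * (N * (N - 1ℚ) * ½)
  {-# INLINE linear-drop #-}

  drop-linear : ∀ lo hi u v (g : ℕ → ℚ) → lo ℕ.≤ hi →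
                (∀ p → lo ℕ.≤ p → p ℕ.< hi → g p - g (suc p) ≡ u + v * ⟦ p ⟧) →
                g lo - g hi ≡ linear-drop u v ⟦ lo ⟧ (⟦ hi ⟧ - ⟦ lo ⟧)
  drop-linear lo hi u v g lo≤hi step = begin
    g lo - g hi
      ≡⟨ cong₂ (λ x y → g x - g y) (sym (ℕ.+-identityʳ lo)) (sym lo+n≡hi) ⟩
    g (lo ℕ.+ 0) - g (lo ℕ.+ n)
      ≡⟨ sym (∑-telescope n (λ q → g (lo ℕ.+ q))) ⟩
    ∑ n (λ q → g (lo ℕ.+ q) - g (lo ℕ.+ suc q))
      ≡⟨ ∑-cong n drops ⟩
    ∑ n (λ q → quadratic u v 0ℚ ⟦ lo ℕ.+ q ⟧)
      ≡⟨ ∑-quadratic n lo u v 0ℚ ⟩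
    ∑quadratic u v 0ℚ ⟦ lo ⟧ ⟦ n ⟧
      ≡⟨ cong (∑quadratic u v 0ℚ ⟦ lo ⟧) (⟦⟧-∸ lo≤hi) ⟩
    ∑quadratic u v 0ℚ ⟦ lo ⟧ (⟦ hi ⟧ - ⟦ lo ⟧)
      ≡⟨ linear u v ⟦ lo ⟧ (⟦ hi ⟧ - ⟦ lo ⟧) ⟩
    linear-drop u v ⟦ lo ⟧ (⟦ hi ⟧ - ⟦ lo ⟧) ∎
    where
    open ≡-Reasoning
    n : ℕ
    n = hi ℕ.∸ lo
    lo+n≡hi : lo ℕ.+ n ≡ hi
    lo+n≡hi = ℕ.m+[n∸m]≡n lo≤hi
    as-quadratic : ∀ u v x → u + v * x ≡ quadratic u v 0ℚ x
    as-quadratic = solve-∀ ringℚ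
    linear : ∀ u v L N → ∑quadratic u v 0ℚ L N ≡ linear-drop u v L N
    linear = solve-∀ ringℚ
    drops : ∀ q → q ℕ.< n → g (lo ℕ.+ q) - g (lo ℕ.+ suc q) ≡ quadratic u v 0ℚ ⟦ lo ℕ.+ q ⟧
    drops q q<n = begin
      g (lo ℕ.+ q) - g (lo ℕ.+ suc q)
        ≡⟨ cong (λ z → g (lo ℕ.+ q) - g z) (ℕ.+-suc lo q) ⟩
      g (lo ℕ.+ q) - g (suc (lo ℕ.+ q))
        ≡⟨ step (lo ℕ.+ q) (ℕ.m≤m+n lo q) (subst (lo ℕ.+ q ℕ.<_) lo+n≡hi (ℕ.+-monoʳ-< lo q<n)) ⟩
      u + v * ⟦ lo ℕ.+ q ⟧
        ≡⟨ as-quadratic u v ⟦ lo ℕ.+ q ⟧ ⟩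
      quadratic u v 0ℚ ⟦ lo ℕ.+ q ⟧ ∎

  zero-drops⇒constant : ∀ k (g : ℕ → ℚ) → (∀ p → suc p ℕ.< k → g p - g (suc p) ≡ 0ℚ) →
                        ∀ q → q ℕ.< k → g q ≡ g 0
  zero-drops⇒constant k g drop≡0 zero    _   = refl
  zero-drops⇒constant k g drop≡0 (suc q) q<k =
    trans (sym (equal (g q) (g (suc q)) (drop≡0 q q<k)))
          (zero-drops⇒constant k g drop≡0 q (ℕ.<-trans (ℕ.n<1+n q) q<k))
    where
    equal : ∀ a b → a - b ≡ 0ℚ → a ≡ b
    equal a b a-b≡0 = trans (restore a b) (trans (cong (b +_) a-b≡0) (+-identityʳ b))
      where
      restore : ∀ a b → a ≡ b + (a - b)
      restore = solve-∀ ringℚ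

  -- Random walks on graphs with vertices 0, …, k-1

  ∀Fin⇒∀< : ∀ {k} {P : ℕ → Set} → (∀ (u : Fin k) → P (toℕ u)) → ∀ p → p ℕ.< k → P p
  ∀Fin⇒∀< {P = P} all p p<k = subst P (Fin.toℕ-fromℕ< p<k) (all (fromℕ< p<k))

  extend : ∀ k → (Fin k → ℚ) → ℕ → ℚ
  extend k f q with q ℕ.<? k
  ... | yes q<k = f (fromℕ< q<k)
  ... | no  _   = 0ℚ

  extend-toℕ : ∀ k (f : Fin k → ℚ) (u : Fin k) → extend k f (toℕ u) ≡ f u
  extend-toℕ k f u with toℕ u ℕ.<? k
  ... | yes u<k = cong f (Fin.fromℕ<-toℕ u u<k)
  ... | no  u≮k = ⊥-elim (u≮k (Fin.toℕ<n u))

  ΣF≡∑ : ∀ {n} (f : ℕ → ℚ) → ΣF {n} (λ u → f (toℕ u)) ≡ ∑ n f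
  ΣF≡∑ {zero}  f = refl
  ΣF≡∑ {suc n} f = cong (f 0 +_) (ΣF≡∑ {n} (λ q → f (suc q)))

  ΣF-cong : ∀ {n} {f g : Fin n → ℚ} → (∀ u → f u ≡ g u) → ΣF f ≡ ΣF g
  ΣF-cong {zero}  f≡g = refl
  ΣF-cong {suc n} f≡g = cong₂ _+_ (f≡g Fin.zero) (ΣF-cong (λ u → f≡g (Fin.suc u)))

  ⟦Σℕ⟧ : ∀ {n} (f : Fin n → ℕ) → ⟦ Σℕ f ⟧ ≡ ΣF (λ u → ⟦ f u ⟧)
  ⟦Σℕ⟧ {zero}  f = refl
  ⟦Σℕ⟧ {suc n} f = trans (⟦⟧-+ (f Fin.zero) _) (cong (⟦ f Fin.zero ⟧ +_) (⟦Σℕ⟧ (λ u → f (Fin.suc u))))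

  Σℕ-nonzero : ∀ {n} (f : Fin n → ℕ) (w : Fin n) → f w ≢ 0 → Σℕ f ≢ 0
  Σℕ-nonzero f Fin.zero    fw≢0 Σ≡0 = fw≢0 (ℕ.m+n≡0⇒m≡0 (f Fin.zero) Σ≡0)
  Σℕ-nonzero f (Fin.suc w) fw≢0 Σ≡0 =
    Σℕ-nonzero (λ u → f (Fin.suc u)) w fw≢0 (ℕ.m+n≡0⇒n≡0 (f Fin.zero) Σ≡0)

  δ : (ℕ → ℚ) → ℕ → ℕ → ℚ
  δ g p q = g p - g q

  restrict : ∀ {k} → (ℕ → ℕ → Bool) → Graph k
  restrict E u v = E (toℕ u) (toℕ v)

  module RandomWalk {k : ℕ} (E : ℕ → ℕ → Bool) (E-sym : ∀ p q → E p q ≡ E q p)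
                    (neighbour : ∀ p → p ℕ.< k → ∃ λ w → w ℕ.< k × E p w ≡ true) where

    G : Graph k
    G = restrict E

    nbr∑ : ℕ → (ℕ → ℚ) → ℚ
    nbr∑ p f = ∑ k (λ q → 𝟙 (E p q) * f q)

    deg : ℕ → ℚ
    deg p = nbr∑ p (λ _ → 1ℚ)

    nbr∑-δ : ∀ p (g : ℕ → ℚ) → nbr∑ p (δ g p) ≡ g p * deg p - nbr∑ p g
    nbr∑-δ p g = begin
      ∑ k (λ q → 𝟙 (E p q) * (g p - g q))                    ≡⟨ ∑-cong k (λ q _ → linear (𝟙 (E p q)) (g p) (g q)) ⟩
      ∑ k (λ q → g p * (𝟙 (E p q) * 1ℚ) - 𝟙 (E p q) * g q)    ≡⟨ ∑-- k _ _ ⟩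
      ∑ k (λ q → g p * (𝟙 (E p q) * 1ℚ)) - nbr∑ p g           ≡⟨ cong (_- nbr∑ p g) (∑-*ˡ k (g p) _) ⟩
      g p * deg p - nbr∑ p g                                 ∎
      where
      open ≡-Reasoning
      linear : ∀ e x y → e * (x - y) ≡ x * (e * 1ℚ) - e * y
      linear = solve-∀ ringℚ

    ⟦degree⟧ : ∀ u → ⟦ degree G u ⟧ ≡ deg (toℕ u)
    ⟦degree⟧ u = begin
      ⟦ degree G u ⟧                              ≡⟨ ⟦Σℕ⟧ (λ v → if G u v then 1 else 0) ⟩
      ΣF {k} (λ v → ⟦ if G u v then 1 else 0 ⟧)   ≡⟨ ΣF-cong {k} (λ v → ⟦if⟧ (G u v)) ⟩
      ΣF {k} (λ v → 𝟙 (G u v) * 1ℚ)               ≡⟨ ΣF≡∑ {k} (λ q → 𝟙 (E (toℕ u) q) * 1ℚ) ⟩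
      deg (toℕ u)                                 ∎
      where
      open ≡-Reasoning
      ⟦if⟧ : ∀ b → ⟦ if b then 1 else 0 ⟧ ≡ 𝟙 b * 1ℚ
      ⟦if⟧ true  = sym (*-identityˡ 1ℚ)
      ⟦if⟧ false = sym (*-zeroˡ 1ℚ)

    deg*inv : ∀ u → deg (toℕ u) * inv (degree G u) ≡ 1ℚ
    deg*inv u with neighbour (toℕ u) (Fin.toℕ<n u)
    ... | w , w<k , u~w =
      trans (cong (_* inv (degree G u)) (sym (⟦degree⟧ u)))
            (⟦⟧*inv (degree G u) (Σℕ-nonzero _ (fromℕ< w<k) edge≢0))
      where
      u~w′ : G u (fromℕ< w<k) ≡ true
      u~w′ = trans (cong (E (toℕ u)) (Fin.toℕ-fromℕ< w<k)) u~w
      edge≢0 : (if G u (fromℕ< w<k) then 1 else 0) ≢ 0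
      edge≢0 = subst (λ b → (if b then 1 else 0) ≢ 0) (sym u~w′) (λ ())

    module Hitting (m : Fin k → Fin k → ℚ) (mfpt : IsMFPT G m) (t : Fin k) where

      h : ℕ → ℚ
      h q = if q ≡ᵇ toℕ t then 0ℚ else extend k (λ l → m l t) q

      h-target : h (toℕ t) ≡ 0ℚ
      h-target rewrite ≡ᵇ-refl (toℕ t) = refl

      h-start : ∀ s → s ≢ t → h (toℕ s) ≡ m s t
      h-start s s≢t rewrite ≡ᵇ-false (λ eq → s≢t (Fin.toℕ-injective eq)) = extend-toℕ k (λ l → m l t) s

      first-step : ∀ p → m p t ≡ 1ℚ + inv (degree G p) * nbr∑ (toℕ p) h
      first-step p = begin
        m p t
          ≡⟨ mfpt p t ⟩
        1ℚ + ΣF (λ l → if ⌊ l Fin.≟ t ⌋ then 0ℚ else P G p l * m l t)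
          ≡⟨ cong (1ℚ +_) (ΣF-cong pointwise) ⟩
        1ℚ + ΣF {k} (λ l → i * (𝟙 (G p l) * h (toℕ l)))
          ≡⟨ cong (1ℚ +_) (ΣF≡∑ {k} (λ q → i * (𝟙 (E (toℕ p) q) * h q))) ⟩
        1ℚ + ∑ k (λ q → i * (𝟙 (E (toℕ p) q) * h q))
          ≡⟨ cong (1ℚ +_) (∑-*ˡ k i _) ⟩
        1ℚ + i * nbr∑ (toℕ p) h ∎
        where
        open ≡-Reasoning
        i : ℚ
        i = inv (degree G p)
        vanish : ∀ i e → i * (e * 0ℚ) ≡ 0ℚ
        vanish = solve-∀ ringℚ
        pointwise : ∀ l → (if ⌊ l Fin.≟ t ⌋ then 0ℚ else P G p l * m l t) ≡ i * (𝟙 (G p l) * h (toℕ l))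
        pointwise l with l Fin.≟ t
        ... | yes refl rewrite h-target = sym (vanish i (𝟙 (G p l)))
        ... | no l≢t rewrite h-start l l≢t with G p l
        ...   | true  = sym (cong (i *_) (*-identityˡ (m l t)))
        ...   | false = trans (*-zeroˡ (m l t)) (sym (trans (cong (i *_) (*-zeroˡ (m l t))) (*-zeroʳ i)))

      hitting-equation : ∀ p → p ℕ.< k → p ≢ toℕ t → nbr∑ p (δ h p) ≡ deg p
      hitting-equation = ∀Fin⇒∀< at-vertex
        where
        expand : ∀ i N d → (1ℚ + i * N) * d - N ≡ d + (d * i) * N - N
        expand = solve-∀ ringℚ
        cancel : ∀ d N → d + 1ℚ * N - N ≡ d
        cancel = solve-∀ ringℚ
        at-vertex : ∀ u → toℕ u ≢ toℕ t → nbr∑ (toℕ u) (δ h (toℕ u)) ≡ deg (toℕ u)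
        at-vertex u u≢t = begin
          nbr∑ (toℕ u) (δ h (toℕ u))
            ≡⟨ nbr∑-δ (toℕ u) h ⟩
          h (toℕ u) * d - N
            ≡⟨ cong (λ z → z * d - N) (trans (h-start u (λ { refl → u≢t refl })) (first-step u)) ⟩
          (1ℚ + i * N) * d - N
            ≡⟨ expand i N d ⟩
          d + (d * i) * N - N
            ≡⟨ cong (λ z → d + z * N - N) (deg*inv u) ⟩
          d + 1ℚ * N - N
            ≡⟨ cancel d N ⟩
          d ∎
          where
          open ≡-Reasoning
          d i N : ℚ
          d = deg (toℕ u)
          i = inv (degree G u)
          N = nbr∑ (toℕ u) h

    module Stationary (π : Fin k → ℚ) (stationary : IsStationary G π) where

      x : ℕ → ℚ
      x = extend k (λ u → π u * inv (degree G u))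

      π≡deg*x : ∀ u → π u ≡ deg (toℕ u) * x (toℕ u)
      π≡deg*x u = begin
        π u                                      ≡⟨ sym (*-identityʳ (π u)) ⟩
        π u * 1ℚ                                 ≡⟨ cong (π u *_) (sym (deg*inv u)) ⟩
        π u * (deg (toℕ u) * inv (degree G u))   ≡⟨ swap (π u) (deg (toℕ u)) (inv (degree G u)) ⟩
        deg (toℕ u) * (π u * inv (degree G u))   ≡⟨ cong (deg (toℕ u) *_) (sym (extend-toℕ k _ u)) ⟩
        deg (toℕ u) * x (toℕ u)                  ∎
        where
        open ≡-Reasoning
        swap : ∀ a b c → a * (b * c) ≡ b * (a * c)
        swap = solve-∀ ringℚ

      balance : ∀ v → nbr∑ (toℕ v) x ≡ π v
      balance v = begin
        nbr∑ (toℕ v) x                        ≡⟨ sym (ΣF≡∑ {k} (λ q → 𝟙 (E (toℕ v) q) * x q)) ⟩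
        ΣF {k} (λ u → 𝟙 (G v u) * x (toℕ u))  ≡⟨ ΣF-cong pointwise ⟩
        ΣF (λ u → π u * P G u v)              ≡⟨ proj₂ (proj₂ stationary) v ⟩
        π v                                   ∎
        where
        open ≡-Reasoning
        pointwise : ∀ u → 𝟙 (G v u) * x (toℕ u) ≡ π u * P G u v
        pointwise u rewrite E-sym (toℕ v) (toℕ u) | extend-toℕ k (λ u → π u * inv (degree G u)) u
          with G u v
        ... | true  = *-identityˡ (π u * inv (degree G u))
        ... | false = trans (*-zeroˡ (π u * inv (degree G u))) (sym (*-zeroʳ (π u)))

      x-harmonic : ∀ p → p ℕ.< k → nbr∑ p (δ x p) ≡ 0ℚ
      x-harmonic = ∀Fin⇒∀< λ v → begin
        nbr∑ (toℕ v) (δ x (toℕ v))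
          ≡⟨ nbr∑-δ (toℕ v) x ⟩
        x (toℕ v) * deg (toℕ v) - nbr∑ (toℕ v) x
          ≡⟨ cong₂ _-_ (trans (*-comm (x (toℕ v)) (deg (toℕ v))) (sym (π≡deg*x v))) (balance v) ⟩
        π v - π v
          ≡⟨ +-inverseʳ (π v) ⟩
        0ℚ ∎
        where open ≡-Reasoning

    kemeny-sum : (π : Fin k → ℚ) (m : Fin k → Fin k → ℚ) (z : Fin k) (H : ℕ → ℚ) (x₀ : ℚ) →
                 toℕ z ≡ 0 → H 0 ≡ 0ℚ → (∀ j → toℕ j ≢ 0 → m z j ≡ H (toℕ j)) →
                 (∀ j → π j ≡ deg (toℕ j) * x₀) →
                 ΣF (λ j → if ⌊ j Fin.≟ z ⌋ then 0ℚ else m z j * π j) ≡ ∑ k (λ q → H q * (deg q * x₀))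
    kemeny-sum π m z H x₀ z≡0 H0≡0 m≡H π≡ = trans (ΣF-cong pointwise) (ΣF≡∑ {k} (λ q → H q * (deg q * x₀)))
      where
      pointwise : ∀ j → (if ⌊ j Fin.≟ z ⌋ then 0ℚ else m z j * π j) ≡ H (toℕ j) * (deg (toℕ j) * x₀)
      pointwise j with j Fin.≟ z
      ... | yes refl = sym (trans (cong (λ q → H q * (deg q * x₀)) z≡0)
                                  (trans (cong (_* (deg 0 * x₀)) H0≡0) (*-zeroˡ (deg 0 * x₀))))
      ... | no j≢z = cong₂ _*_ (m≡H j (λ j≡0 → j≢z (Fin.toℕ-injective (trans j≡0 (sym z≡0))))) (π≡ j)

    total-mass : (π : Fin k → ℚ) (x₀ : ℚ) → ΣF π ≡ 1ℚ → (∀ j → π j ≡ deg (toℕ j) * x₀) → ∑ k deg * x₀ ≡ 1ℚ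
    total-mass π x₀ Σπ≡1 π≡ = begin
      ∑ k deg * x₀                     ≡⟨ *-comm (∑ k deg) x₀ ⟩
      x₀ * ∑ k deg                     ≡⟨ sym (∑-*ˡ k x₀ deg) ⟩
      ∑ k (λ q → x₀ * deg q)           ≡⟨ ∑-cong k (λ q _ → *-comm x₀ (deg q)) ⟩
      ∑ k (λ q → deg q * x₀)           ≡⟨ sym (ΣF≡∑ {k} (λ q → deg q * x₀)) ⟩
      ΣF {k} (λ j → deg (toℕ j) * x₀)  ≡⟨ sym (ΣF-cong π≡) ⟩
      ΣF π                             ≡⟨ Σπ≡1 ⟩
      1ℚ                               ∎
      where open ≡-Reasoning

  -- Neighbourhoods in the path and in the path with a chord

  pathE : ℕ → ℕ → Bool
  pathE p q = (suc p ≡ᵇ q) ∨ (suc q ≡ᵇ p)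

  chordE : ℕ → ℕ → ℕ → ℕ → Bool
  chordE A B p q = pathE p q ∨ (((p ≡ᵇ A) ∧ (q ≡ᵇ B)) ∨ ((p ≡ᵇ B) ∧ (q ≡ᵇ A)))

  pathE-sym : ∀ p q → pathE p q ≡ pathE q p
  pathE-sym p q = Bool.∨-comm (suc p ≡ᵇ q) (suc q ≡ᵇ p)

  chordE-sym : ∀ A B p q → chordE A B p q ≡ chordE A B q p
  chordE-sym A B p q
    rewrite pathE-sym p q | Bool.∧-comm (p ≡ᵇ A) (q ≡ᵇ B) | Bool.∧-comm (p ≡ᵇ B) (q ≡ᵇ A)
    = cong (pathE q p ∨_) (Bool.∨-comm ((q ≡ᵇ B) ∧ (p ≡ᵇ A)) ((q ≡ᵇ A) ∧ (p ≡ᵇ B)))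

  pathE-exclusive : ∀ p q → (suc q ≡ᵇ p) ≡ true → (suc p ≡ᵇ q) ≡ false
  pathE-exclusive p q eq with ≡ᵇ-true⇒≡ {suc q} {p} eq
  ... | refl = ≡ᵇ-false {suc (suc q)} {q} (λ eq′ → ℕ.<-irrefl (sym eq′) (ℕ.m≤n⇒m≤1+n ℕ.≤-refl))

  path-neighbour : ∀ k → 1 ℕ.< k → ∀ p → p ℕ.< k → ∃ λ w → w ℕ.< k × pathE p w ≡ true
  path-neighbour k 1<k zero    _   = 1 , 1<k , refl
  path-neighbour k _   (suc p) p<k =
    p , ℕ.<-trans (ℕ.n<1+n p) p<k , trans (cong ((suc (suc p) ≡ᵇ p) ∨_) (≡ᵇ-refl p)) (Bool.∨-zeroʳ _)

  -- What a neighbour sum at p picks up from p - 1, from p + 1, and from the chord {A, B}.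
  left : ℕ → (ℕ → ℚ) → ℚ
  left zero    f = 0ℚ
  left (suc p) f = f p

  right : ℕ → ℕ → (ℕ → ℚ) → ℚ
  right k p f = 𝟙 (suc p <ᵇ k) * f (suc p)

  across : ℕ → ℕ → ℕ → (ℕ → ℚ) → ℚ
  across A B p f = 𝟙 (p ≡ᵇ A) * f B + 𝟙 (p ≡ᵇ B) * f A

  one : ℕ → ℚ
  one _ = 1ℚ

  ∑-pathE : ∀ k p (f : ℕ → ℚ) → p ℕ.< k → ∑ k (λ q → 𝟙 (pathE p q) * f q) ≡ left p f + right k p f
  ∑-pathE k p f p<k = begin
    ∑ k (λ q → 𝟙 (pathE p q) * f q)
      ≡⟨ ∑-cong k (λ q _ → split q) ⟩
    ∑ k (λ q → 𝟙 (q ≡ᵇ suc p) * f q + 𝟙 (suc q ≡ᵇ p) * f q)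
      ≡⟨ ∑-+ k _ _ ⟩
    ∑ k (λ q → 𝟙 (q ≡ᵇ suc p) * f q) + ∑ k (λ q → 𝟙 (suc q ≡ᵇ p) * f q)
      ≡⟨ cong₂ _+_ (∑-δ k (suc p) f) (from-left p p<k) ⟩
    right k p f + left p f
      ≡⟨ +-comm (right k p f) (left p f) ⟩
    left p f + right k p f ∎
    where
    open ≡-Reasoning
    split : ∀ q → 𝟙 (pathE p q) * f q ≡ 𝟙 (q ≡ᵇ suc p) * f q + 𝟙 (suc q ≡ᵇ p) * f q
    split q rewrite 𝟙-∨ (suc p ≡ᵇ q) (suc q ≡ᵇ p) (pathE-exclusive p q) | ≡ᵇ-sym (suc p) q =
      *-distribʳ-+ (f q) (𝟙 (q ≡ᵇ suc p)) (𝟙 (suc q ≡ᵇ p))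
    from-left : ∀ p → p ℕ.< k → ∑ k (λ q → 𝟙 (suc q ≡ᵇ p) * f q) ≡ left p f
    from-left zero    _   = ∑-0* k f
    from-left (suc p) p<k rewrite ∑-δ k p f | <ᵇ-true (ℕ.<-trans (ℕ.n<1+n p) p<k) = *-identityˡ (f p)

  right-interior : ∀ k (g : ℕ → ℚ) p → suc p ℕ.< k → right k p (δ g p) ≡ g p - g (suc p)
  right-interior k g p p+1<k rewrite <ᵇ-true p+1<k = *-identityˡ (g p - g (suc p))

  ∑-pathFlux : ∀ k (g : ℕ → ℚ) p → p ℕ.< k →
               ∑ (suc p) (λ q → left q (δ g q) + right k q (δ g q)) ≡ right k p (δ g p)
  ∑-pathFlux k g zero    _   = first (right k 0 (δ g 0))
    where
    first : ∀ r → (0ℚ + r) + 0ℚ ≡ r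
    first = solve-∀ ringℚ
  ∑-pathFlux k g (suc p) p<k = begin
    ∑ (suc (suc p)) F
      ≡⟨ ∑-last (suc p) F ⟩
    ∑ (suc p) F + F (suc p)
      ≡⟨ cong (_+ F (suc p)) (∑-pathFlux k g p (ℕ.<-trans (ℕ.n<1+n p) p<k)) ⟩
    right k p (δ g p) + F (suc p)
      ≡⟨ cong (_+ F (suc p)) (right-interior k g p p<k) ⟩
    (g p - g (suc p)) + ((g (suc p) - g p) + right k (suc p) (δ g (suc p)))
      ≡⟨ cancel (g p) (g (suc p)) _ ⟩
    right k (suc p) (δ g (suc p)) ∎
    where
    open ≡-Reasoning
    F : ℕ → ℚ
    F q = left q (δ g q) + right k q (δ g q)
    cancel : ∀ a b r → (a - b) + ((b - a) + r) ≡ r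
    cancel = solve-∀ ringℚ

  ∑-across : ∀ A B n (g : ℕ → ℚ) →
             ∑ n (λ q → across A B q (δ g q)) ≡ (𝟙 (A <ᵇ n) - 𝟙 (B <ᵇ n)) * (g A - g B)
  ∑-across A B n g = begin
    ∑ n (λ q → across A B q (δ g q))
      ≡⟨ ∑-+ n _ _ ⟩
    ∑ n (λ q → 𝟙 (q ≡ᵇ A) * (g q - g B)) + ∑ n (λ q → 𝟙 (q ≡ᵇ B) * (g q - g A))
      ≡⟨ cong₂ _+_ (∑-δ n A (λ q → g q - g B)) (∑-δ n B (λ q → g q - g A)) ⟩
    𝟙 (A <ᵇ n) * (g A - g B) + 𝟙 (B <ᵇ n) * (g B - g A)
      ≡⟨ collect (𝟙 (A <ᵇ n)) (𝟙 (B <ᵇ n)) (g A) (g B) ⟩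
    (𝟙 (A <ᵇ n) - 𝟙 (B <ᵇ n)) * (g A - g B) ∎
    where
    open ≡-Reasoning
    collect : ∀ a b x y → a * (x - y) + b * (y - x) ≡ (a - b) * (x - y)
    collect = solve-∀ ringℚ

  count-left : ∀ p → ∑ (suc p) (λ q → left q one) ≡ ⟦ p ⟧
  count-left zero    = +-identityˡ 0ℚ
  count-left (suc p) =
    trans (∑-last (suc p) (λ q → left q one)) (trans (cong (_+ 1ℚ) (count-left p)) (+-comm ⟦ p ⟧ 1ℚ))

  count-right : ∀ k p → p ℕ.< k → ∑ (suc p) (λ q → right k q one) ≡ ⟦ p ⟧ + 𝟙 (suc p <ᵇ k)
  count-right k zero    _   = first (𝟙 (1 <ᵇ k))
    where
    first : ∀ r → r * 1ℚ + 0ℚ ≡ 0ℚ + r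
    first = solve-∀ ringℚ
  count-right k (suc p) p<k = begin
    ∑ (suc (suc p)) (λ q → right k q one)
      ≡⟨ ∑-last (suc p) (λ q → right k q one) ⟩
    ∑ (suc p) (λ q → right k q one) + right k (suc p) one
      ≡⟨ cong (_+ right k (suc p) one) (count-right k p (ℕ.<-trans (ℕ.n<1+n p) p<k)) ⟩
    ⟦ p ⟧ + 𝟙 (suc p <ᵇ k) + right k (suc p) one
      ≡⟨ cong (λ b → ⟦ p ⟧ + 𝟙 b + right k (suc p) one) (<ᵇ-true p<k) ⟩
    ⟦ p ⟧ + 1ℚ + 𝟙 (suc (suc p) <ᵇ k) * 1ℚ
      ≡⟨ shift ⟦ p ⟧ (𝟙 (suc (suc p) <ᵇ k)) ⟩
    ⟦ suc p ⟧ + 𝟙 (suc (suc p) <ᵇ k) ∎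
    where
    open ≡-Reasoning
    shift : ∀ x r → x + 1ℚ + r * 1ℚ ≡ (1ℚ + x) + r
    shift = solve-∀ ringℚ

  count-across : ∀ A B n → ∑ n (λ q → across A B q one) ≡ 𝟙 (A <ᵇ n) + 𝟙 (B <ᵇ n)
  count-across A B n =
    trans (∑-+ n _ _) (trans (cong₂ _+_ (∑-δ n A one) (∑-δ n B one))
                             (cong₂ _+_ (*-identityʳ (𝟙 (A <ᵇ n))) (*-identityʳ (𝟙 (B <ᵇ n)))))

  ∑-left* : ∀ n (f : ℕ → ℚ) → ∑ (suc n) (λ q → left q one * f q) ≡ ∑ n (λ q → f (suc q))
  ∑-left* n f = trans (cong (_+ ∑ n (λ q → 1ℚ * f (suc q))) (*-zeroˡ (f 0)))
                      (trans (+-identityˡ _) (∑-cong n (λ q _ → *-identityˡ (f (suc q)))))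

  ∑-right* : ∀ n (f : ℕ → ℚ) → ∑ (suc n) (λ q → right (suc n) q one * f q) ≡ ∑ n f
  ∑-right* zero    f = trans (+-identityʳ _) (trans (cong (_* f 0) (*-zeroˡ 1ℚ)) (*-zeroˡ (f 0)))
  ∑-right* (suc n) f =
    cong₂ _+_ (trans (cong (_* f 0) (*-identityˡ 1ℚ)) (*-identityˡ (f 0))) (∑-right* n (λ q → f (suc q)))

  module ChordNeighbours (A B k : ℕ) (A+2≤B : suc (suc A) ℕ.≤ B) (B<k : B ℕ.< k) where

    A<B : A ℕ.< B
    A<B = ℕ.<-trans (ℕ.n<1+n A) A+2≤B

    A<k : A ℕ.< k
    A<k = ℕ.<-trans A<B B<k

    A≢B : A ≢ B
    A≢B = ℕ.<⇒≢ A<B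

    pathE-AB : pathE A B ≡ false
    pathE-AB
      rewrite ≡ᵇ-false {suc A} {B} (ℕ.<⇒≢ A+2≤B) | ≡ᵇ-false {suc B} {A} (ℕ.>⇒≢ (ℕ.<-trans A<B (ℕ.n<1+n B)))
      = refl

    chord-exclusive : ∀ p q → (((p ≡ᵇ A) ∧ (q ≡ᵇ B)) ∨ ((p ≡ᵇ B) ∧ (q ≡ᵇ A))) ≡ true → pathE p q ≡ false
    chord-exclusive p q eq with p ≡ᵇ A in pA | q ≡ᵇ B in qB | p ≡ᵇ B in pB | q ≡ᵇ A in qA
    ... | true  | true  | _     | _    rewrite ≡ᵇ-true⇒≡ {p} pA | ≡ᵇ-true⇒≡ {q} qB = pathE-AB
    ... | _     | _     | true  | true rewrite ≡ᵇ-true⇒≡ {p} pB | ≡ᵇ-true⇒≡ {q} qA = trans (pathE-sym B A) pathE-AB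
    ... | true  | false | true  | false = ⊥-elim (A≢B (trans (sym (≡ᵇ-true⇒≡ {p} pA)) (≡ᵇ-true⇒≡ {p} pB)))
    ... | true  | false | false | _     with () ← eq
    ... | false | _     | false | _     with () ← eq
    ... | false | _     | true  | false with () ← eq

    orientations-exclusive : ∀ p q → ((p ≡ᵇ B) ∧ (q ≡ᵇ A)) ≡ true → ((p ≡ᵇ A) ∧ (q ≡ᵇ B)) ≡ false
    orientations-exclusive p q eq with p ≡ᵇ B in pB
    ... | true rewrite ≡ᵇ-true⇒≡ {p} pB | ≡ᵇ-false {B} {A} (≢-sym A≢B) = refl

    chord-neighbour : ∀ p → p ℕ.< k → ∃ λ w → w ℕ.< k × chordE A B p w ≡ true
    chord-neighbour p p<k with path-neighbour k (ℕ.≤-<-trans (s≤s z≤n) (ℕ.<-≤-trans A+2≤B (ℕ.<⇒≤ B<k))) p p<k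
    ... | w , w<k , p~w = w , w<k , cong (_∨ (((p ≡ᵇ A) ∧ (w ≡ᵇ B)) ∨ ((p ≡ᵇ B) ∧ (w ≡ᵇ A)))) p~w

    ∑-chordE : ∀ p (f : ℕ → ℚ) → p ℕ.< k →
               ∑ k (λ q → 𝟙 (chordE A B p q) * f q) ≡ (left p f + right k p f) + across A B p f
    ∑-chordE p f p<k = begin
      ∑ k (λ q → 𝟙 (chordE A B p q) * f q)
        ≡⟨ ∑-cong k (λ q _ → split q) ⟩
      ∑ k (λ q → onPath q + (toB q + toA q))
        ≡⟨ trans (∑-+ k onPath _) (cong (∑ k onPath +_) (∑-+ k toB toA)) ⟩
      ∑ k onPath + (∑ k toB + ∑ k toA)
        ≡⟨ cong₂ _+_ (∑-pathE k p f p<k) (cong₂ _+_ (endpoint A B B<k) (endpoint B A A<k)) ⟩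
      (left p f + right k p f) + across A B p f ∎
      where
      open ≡-Reasoning
      onPath toB toA : ℕ → ℚ
      onPath q = 𝟙 (pathE p q) * f q
      toB q = 𝟙 (p ≡ᵇ A) * (𝟙 (q ≡ᵇ B) * f q)
      toA q = 𝟙 (p ≡ᵇ B) * (𝟙 (q ≡ᵇ A) * f q)
      distribute : ∀ a b c d e x → (a + (b * c + d * e)) * x ≡ a * x + (b * (c * x) + d * (e * x))
      distribute = solve-∀ ringℚ
      split : ∀ q → 𝟙 (chordE A B p q) * f q ≡ onPath q + (toB q + toA q)
      split q rewrite 𝟙-∨ (pathE p q) _ (chord-exclusive p q)
                    | 𝟙-∨ ((p ≡ᵇ A) ∧ (q ≡ᵇ B)) _ (orientations-exclusive p q)
                    | 𝟙-∧ (p ≡ᵇ A) (q ≡ᵇ B) | 𝟙-∧ (p ≡ᵇ B) (q ≡ᵇ A)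
                    = distribute (𝟙 (pathE p q)) (𝟙 (p ≡ᵇ A)) (𝟙 (q ≡ᵇ B)) (𝟙 (p ≡ᵇ B)) (𝟙 (q ≡ᵇ A)) (f q)
      endpoint : ∀ X Y → Y ℕ.< k → ∑ k (λ q → 𝟙 (p ≡ᵇ X) * (𝟙 (q ≡ᵇ Y) * f q)) ≡ 𝟙 (p ≡ᵇ X) * f Y
      endpoint X Y Y<k rewrite ∑-*ˡ k (𝟙 (p ≡ᵇ X)) (λ q → 𝟙 (q ≡ᵇ Y) * f q) | ∑-δ k Y f | <ᵇ-true Y<k =
        cong (𝟙 (p ≡ᵇ X) *_) (*-identityˡ (f Y))

  -- Kemeny's constant of the path

  κ-path : ℚ → ℚ
  κ-path K = (2 * K * K - 4 * K + 3) * sixth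
  {-# INLINE κ-path #-}

  module PathWalk (n : ℕ) where

    k : ℕ
    k = suc (suc n)

    open RandomWalk {k} pathE pathE-sym (path-neighbour k (s≤s (s≤s z≤n))) public

    ∑-flux : ∀ (g : ℕ → ℚ) p → p ℕ.< k → ∑ (suc p) (λ q → nbr∑ q (δ g q)) ≡ right k p (δ g p)
    ∑-flux g p p<k =
      trans (∑-cong (suc p) (λ q q≤p → ∑-pathE k q (δ g q) (ℕ.≤-<-trans (ℕ.≤-pred q≤p) p<k))) (∑-pathFlux k g p p<k)

    deg≡ : ∀ q → q ℕ.< k → deg q ≡ left q one + right k q one
    deg≡ q = ∑-pathE k q one

    ∑deg : ∀ p → p ℕ.< k → ∑ (suc p) deg ≡ ⟦ p ⟧ + (⟦ p ⟧ + 𝟙 (suc p <ᵇ k))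
    ∑deg p p<k = begin
      ∑ (suc p) deg
        ≡⟨ ∑-cong (suc p) (λ q q≤p → deg≡ q (ℕ.≤-<-trans (ℕ.≤-pred q≤p) p<k)) ⟩
      ∑ (suc p) (λ q → left q one + right k q one)
        ≡⟨ ∑-+ (suc p) (λ q → left q one) (λ q → right k q one) ⟩
      ∑ (suc p) (λ q → left q one) + ∑ (suc p) (λ q → right k q one)
        ≡⟨ cong₂ _+_ (count-left p) (count-right k p p<k) ⟩
      ⟦ p ⟧ + (⟦ p ⟧ + 𝟙 (suc p <ᵇ k)) ∎
      where open ≡-Reasoning

    volume : ∑ k deg ≡ ⟦ suc n ⟧ + ⟦ suc n ⟧
    volume = trans (∑deg (suc n) ℕ.≤-refl)
                   (trans (cong (λ b → ⟦ suc n ⟧ + (⟦ suc n ⟧ + 𝟙 b)) (<ᵇ-false {k} ℕ.≤-refl))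
                          (cong (⟦ suc n ⟧ +_) (+-identityʳ ⟦ suc n ⟧)))

    ∑deg* : ∀ (f : ℕ → ℚ) → ∑ k (λ q → deg q * f q) ≡ ∑ (suc n) (λ q → f (suc q)) + ∑ (suc n) f
    ∑deg* f = begin
      ∑ k (λ q → deg q * f q)
        ≡⟨ ∑-cong k (λ q q<k → trans (cong (_* f q) (deg≡ q q<k))
          (*-distribʳ-+ (f q) (left q one) (right k q one))) ⟩
      ∑ k (λ q → left q one * f q + right k q one * f q)
        ≡⟨ ∑-+ k (λ q → left q one * f q) (λ q → right k q one * f q) ⟩
      ∑ k (λ q → left q one * f q) + ∑ k (λ q → right k q one * f q)
        ≡⟨ cong₂ _+_ (∑-left* (suc n) f) (∑-right* (suc n) f) ⟩
      ∑ (suc n) (λ q → f (suc q)) + ∑ (suc n) f ∎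
      where open ≡-Reasoning

    module PathHitting (m : Fin k → Fin k → ℚ) (mfpt : IsMFPT G m) (t : Fin k) where
      open Hitting m mfpt t

      drop-before-target : ∀ p → suc p ℕ.< k → p ℕ.< toℕ t → h p - h (suc p) ≡ 1ℚ + 2 * ⟦ p ⟧
      drop-before-target p p+1<k p<t = begin
        h p - h (suc p)                    ≡⟨ sym (right-interior k h p p+1<k) ⟩
        right k p (δ h p)                  ≡⟨ sym (∑-flux h p p<k) ⟩
        ∑ (suc p) (λ q → nbr∑ q (δ h q))   ≡⟨ ∑-cong (suc p) (λ q q≤p → hitting-equation q (ℕ.<-trans q≤p p+1<k)
                                                                          (ℕ.<⇒≢ (ℕ.≤-<-trans (ℕ.≤-pred q≤p) p<t))) ⟩
        ∑ (suc p) deg                      ≡⟨ ∑deg p p<k ⟩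
        ⟦ p ⟧ + (⟦ p ⟧ + 𝟙 (suc p <ᵇ k))   ≡⟨ cong (λ b → ⟦ p ⟧ + (⟦ p ⟧ + 𝟙 b)) (<ᵇ-true p+1<k) ⟩
        ⟦ p ⟧ + (⟦ p ⟧ + 1ℚ)               ≡⟨ collect ⟦ p ⟧ ⟩
        1ℚ + 2 * ⟦ p ⟧                     ∎
        where
        open ≡-Reasoning
        p<k : p ℕ.< k
        p<k = ℕ.<-trans (ℕ.n<1+n p) p+1<k
        collect : ∀ x → x + (x + 1ℚ) ≡ 1ℚ + 2 * x
        collect = solve-∀ ringℚ

      hitting-time : Fin.zero ≢ t → m Fin.zero t ≡ ⟦ toℕ t ⟧ * ⟦ toℕ t ⟧
      hitting-time 0≢t = begin
        m Fin.zero t                           ≡⟨ sym (h-start Fin.zero 0≢t) ⟩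
        h 0                                    ≡⟨ sym (trans (cong (λ z → h 0 - z) h-target) (+-identityʳ (h 0))) ⟩
        h 0 - h (toℕ t)                        ≡⟨ drop-linear 0 (toℕ t) 1ℚ 2 h z≤n drops ⟩
        linear-drop 1ℚ 2 0ℚ (⟦ toℕ t ⟧ - 0ℚ)   ≡⟨ square ⟦ toℕ t ⟧ ⟩
        ⟦ toℕ t ⟧ * ⟦ toℕ t ⟧                  ∎
        where
        open ≡-Reasoning
        square : ∀ T → linear-drop 1ℚ 2 0ℚ (T - 0ℚ) ≡ T * T
        square = solve-∀ ringℚ
        drops : ∀ p → 0 ℕ.≤ p → p ℕ.< toℕ t → h p - h (suc p) ≡ 1ℚ + 2 * ⟦ p ⟧
        drops p _ p<t = drop-before-target p (ℕ.<-≤-trans (s≤s p<t) (Fin.toℕ<n t)) p<t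

    module PathStationary (π : Fin k → ℚ) (stationary : IsStationary G π) where
      open Stationary π stationary public

      x-constant : ∀ q → q ℕ.< k → x q ≡ x 0
      x-constant = zero-drops⇒constant k x drop≡0
        where
        drop≡0 : ∀ p → suc p ℕ.< k → x p - x (suc p) ≡ 0ℚ
        drop≡0 p p+1<k = begin
          x p - x (suc p)                   ≡⟨ sym (right-interior k x p p+1<k) ⟩
          right k p (δ x p)                 ≡⟨ sym (∑-flux x p (ℕ.<-trans (ℕ.n<1+n p) p+1<k)) ⟩
          ∑ (suc p) (λ q → nbr∑ q (δ x q))  ≡⟨ ∑-cong (suc p) (λ q q≤p → x-harmonic q (ℕ.<-trans q≤p p+1<k)) ⟩
          ∑ (suc p) (λ _ → 0ℚ)              ≡⟨ ∑-0 (suc p) ⟩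
          0ℚ                                ∎
          where open ≡-Reasoning

  path-kemeny : ∀ {k} → 2 ℕ.≤ k → ∀ κ → IsKemeny (path k) κ → κ ≡ κ-path ⟦ k ⟧
  path-kemeny {suc (suc n)} (s≤s (s≤s z≤n)) κ (π , m , stationary , mfpt , kemeny) = begin
    κ
      ≡⟨ kemeny Fin.zero ⟩
    _
      ≡⟨ kemeny-sum π m Fin.zero H x₀ refl (*-zeroˡ 0ℚ) hit π≡ ⟩
    ∑ k (λ q → H q * (deg q * x₀))
      ≡⟨ ∑-cong k (λ q _ → rearrange (H q) (deg q) x₀) ⟩
    ∑ k (λ q → x₀ * (deg q * H q))
      ≡⟨ ∑-*ˡ k x₀ (λ q → deg q * H q) ⟩
    x₀ * ∑ k (λ q → deg q * H q)
      ≡⟨ cong (x₀ *_) (∑deg* H) ⟩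
    x₀ * (∑ (suc n) (λ q → H (suc q)) + ∑ (suc n) H)
      ≡⟨ cong (x₀ *_) (cong₂ _+_ (∑-quadratic (suc n) 1 0ℚ 0ℚ 1ℚ)
        (∑-quadratic (suc n) 0 0ℚ 0ℚ 1ℚ)) ⟩
    x₀ * (∑quadratic 0ℚ 0ℚ 1ℚ 1ℚ N + ∑quadratic 0ℚ 0ℚ 1ℚ 0ℚ N)
      ≡⟨ closed-form x₀ N ⟩
    ((N + N) * x₀) * κ-path (1ℚ + N)
      ≡⟨ cong (_* κ-path (1ℚ + N)) mass ⟩
    1ℚ * κ-path (1ℚ + N)
      ≡⟨ *-identityˡ _ ⟩
    κ-path ⟦ suc (suc n) ⟧ ∎
    where
    open ≡-Reasoning
    open PathWalk n
    open PathStationary π stationary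
    N x₀ : ℚ
    N = ⟦ suc n ⟧
    x₀ = x 0
    H : ℕ → ℚ
    H q = quadratic 0ℚ 0ℚ 1ℚ ⟦ q ⟧
    π≡ : ∀ j → π j ≡ deg (toℕ j) * x₀
    π≡ j = trans (π≡deg*x j) (cong (deg (toℕ j) *_) (x-constant (toℕ j) (Fin.toℕ<n j)))
    mass : (N + N) * x₀ ≡ 1ℚ
    mass = trans (cong (_* x₀) (sym volume)) (total-mass π x₀ (proj₁ (proj₂ stationary)) π≡)
    as-quadratic : ∀ T → T * T ≡ quadratic 0ℚ 0ℚ 1ℚ T
    as-quadratic = solve-∀ ringℚ
    hit : ∀ j → toℕ j ≢ 0 → m Fin.zero j ≡ H (toℕ j)
    hit j j≢0 = trans (PathHitting.hitting-time m mfpt j (λ 0≡j → j≢0 (sym (cong toℕ 0≡j)))) (as-quadratic ⟦ toℕ j ⟧)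
    rearrange : ∀ h d x → h * (d * x) ≡ x * (d * h)
    rearrange = solve-∀ ringℚ
    closed-form : ∀ x N → x * (∑quadratic 0ℚ 0ℚ 1ℚ 1ℚ N + ∑quadratic 0ℚ 0ℚ 1ℚ 0ℚ N) ≡ ((N + N) * x) * κ-path (1ℚ + N)
    closed-form = solve-∀ ringℚ

  -- Kemeny's constant of the path with a chord

  cycle-length : ℚ → ℚ → ℚ
  cycle-length α β = β - α + 1ℚ
  {-# INLINE cycle-length #-}

  cycle-drop : ℚ → ℚ → ℚ
  cycle-drop α β = β * (β + 1ℚ) - α * (α + 1ℚ)
  {-# INLINE cycle-drop #-}

  -- With the chord joining the vertices α < β of a path on K vertices numbered from 0, these are
  -- cycle-length α β times the mean first passage time from 0 to T, for T ≤ α, α < T < β and β ≤ T.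
  hit-left : ℚ → ℚ → ℚ → ℚ
  hit-left α β T = cycle-length α β * (T * T)
  {-# INLINE hit-left #-}

  hit-cycle : ℚ → ℚ → ℚ → ℚ → ℚ
  hit-cycle α β K T = cycle-length α β * (T * T + T - α) - (T - α) * (cycle-drop α β - 2 * K * (β - T))
  {-# INLINE hit-cycle #-}

  hit-right : ℚ → ℚ → ℚ → ℚ
  hit-right α β T = cycle-length α β * (α * α + (T - β) * (T + β + 2)) + cycle-drop α β
  {-# INLINE hit-right #-}

  hit-cycle₀ hit-cycle₁ hit-cycle₂ : ℚ → ℚ → ℚ → ℚ
  hit-cycle₀ α β K = α * cycle-drop α β - cycle-length α β * α - 2 * K * β * α
  hit-cycle₁ α β K = cycle-length α β - cycle-drop α β + 2 * K * (α + β)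
  hit-cycle₂ α β K = cycle-length α β - 2 * K
  {-# INLINE hit-cycle₀ #-}
  {-# INLINE hit-cycle₁ #-}
  {-# INLINE hit-cycle₂ #-}

  hit-right₀ : ℚ → ℚ → ℚ
  hit-right₀ α β = cycle-length α β * (α * α - β * β - 2 * β) + cycle-drop α β
  {-# INLINE hit-right₀ #-}

  hit-left-quadratic : ∀ α β T → hit-left α β T ≡ quadratic 0ℚ 0ℚ (cycle-length α β) T
  hit-left-quadratic = solve-∀ ringℚ

  hit-cycle-quadratic : ∀ α β K T →
                        hit-cycle α β K T ≡ quadratic (hit-cycle₀ α β K) (hit-cycle₁ α β K) (hit-cycle₂ α β K) T
  hit-cycle-quadratic = solve-∀ ringℚ

  hit-right-quadratic : ∀ α β T →
                        hit-right α β T ≡ quadratic (hit-right₀ α β) (2 * cycle-length α β) (cycle-length α β) T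
  hit-right-quadratic = solve-∀ ringℚ

  solve-cycle : ∀ α β K T χ g₀ gA gT gB →
                g₀ - gA ≡ linear-drop 1ℚ 2 0ℚ (α - 0ℚ) →
                gA - gT ≡ linear-drop (2 - χ) 2 α (T - α) →
                gT - gB ≡ linear-drop (2 - χ - 2 * K) 2 T (β - T) →
                gT ≡ 0ℚ → χ ≡ gA - gB →
                cycle-length α β * g₀ ≡ hit-cycle α β K T
  solve-cycle α β K T χ g₀ gA gT gB d₀ d₁ d₂ gT≡0 χ≡ = begin
    c * g₀                                   ≡⟨ regroup α β g₀ gA gT ⟩
    c * ((g₀ - gA) + (gA - gT) + gT)         ≡⟨ cong₂ (λ u v → c * (u + v + gT)) d₀ d₁ ⟩
    c * (S₀ + S₁ + gT)                       ≡⟨ cong (λ z → c * (S₀ + S₁ + z)) gT≡0 ⟩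
    c * (S₀ + S₁ + 0ℚ)                       ≡⟨ extract α β T χ ⟩
    c * (S₀ + S₁⁰) - (T - α) * (c * χ)       ≡⟨ cong (λ z → c * (S₀ + S₁⁰) - (T - α) * z) cχ ⟩
    c * (S₀ + S₁⁰) - (T - α) * (S₁⁰ + S₂⁰)   ≡⟨ closed α β K T ⟩
    hit-cycle α β K T                        ∎
    where
    open ≡-Reasoning
    c S₀ S₁ S₂ S₁⁰ S₂⁰ : ℚ
    c = cycle-length α β
    S₀ = linear-drop 1ℚ 2 0ℚ (α - 0ℚ)
    S₁ = linear-drop (2 - χ) 2 α (T - α)
    S₂ = linear-drop (2 - χ - 2 * K) 2 T (β - T)
    S₁⁰ = linear-drop 2 2 α (T - α)
    S₂⁰ = linear-drop (2 - 2 * K) 2 T (β - T)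
    regroup : ∀ α β g₀ gA gT → cycle-length α β * g₀ ≡ cycle-length α β * ((g₀ - gA) + (gA - gT) + gT)
    regroup = solve-∀ ringℚ
    extract : ∀ α β T χ →
      cycle-length α β * (linear-drop 1ℚ 2 0ℚ (α - 0ℚ) + linear-drop (2 - χ) 2 α (T - α) + 0ℚ)
      ≡ cycle-length α β * (linear-drop 1ℚ 2 0ℚ (α - 0ℚ) + linear-drop 2 2 α (T - α)) - (T - α) * (cycle-length α β * χ)
    extract = solve-∀ ringℚ
    closed : ∀ α β K T →
      cycle-length α β * (linear-drop 1ℚ 2 0ℚ (α - 0ℚ) + linear-drop 2 2 α (T - α))
        - (T - α) * (linear-drop 2 2 α (T - α) + linear-drop (2 - 2 * K) 2 T (β - T))
      ≡ hit-cycle α β K T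
    closed = solve-∀ ringℚ
    split : ∀ x y z → x - z ≡ (x - y) + (y - z)
    split = solve-∀ ringℚ
    spread : ∀ α β χ → cycle-length α β * χ ≡ χ + (β - α) * χ
    spread = solve-∀ ringℚ
    absorb : ∀ α β K T χ →
      (linear-drop (2 - χ) 2 α (T - α) + linear-drop (2 - χ - 2 * K) 2 T (β - T)) + (β - α) * χ
      ≡ linear-drop 2 2 α (T - α) + linear-drop (2 - 2 * K) 2 T (β - T)
    absorb = solve-∀ ringℚ
    cχ : c * χ ≡ S₁⁰ + S₂⁰
    cχ = begin
      c * χ                                  ≡⟨ spread α β χ ⟩
      χ + (β - α) * χ                        ≡⟨ cong (_+ (β - α) * χ) (trans χ≡ (split gA gT gB)) ⟩
      ((gA - gT) + (gT - gB)) + (β - α) * χ  ≡⟨ cong₂ (λ u v → (u + v) + (β - α) * χ) d₁ d₂ ⟩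
      (S₁ + S₂) + (β - α) * χ                ≡⟨ absorb α β K T χ ⟩
      S₁⁰ + S₂⁰                              ∎

  solve-right : ∀ α β T χ g₀ gA gB gT →
                g₀ - gA ≡ linear-drop 1ℚ 2 0ℚ (α - 0ℚ) →
                gA - gB ≡ linear-drop (2 - χ) 2 α (β - α) →
                gB - gT ≡ linear-drop 3 2 β (T - β) →
                gT ≡ 0ℚ → χ ≡ gA - gB →
                cycle-length α β * g₀ ≡ hit-right α β T
  solve-right α β T χ g₀ gA gB gT d₀ d₁ d₂ gT≡0 χ≡ = begin
    c * g₀                                          ≡⟨ regroup α β g₀ gA gB gT ⟩
    c * ((g₀ - gA) + (gB - gT) + gT) + c * (gA - gB) ≡⟨ cong₂ (λ u v → c * (u + v + gT) + c * (gA - gB)) d₀ d₂ ⟩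
    c * (S₀ + S₃ + gT) + c * (gA - gB)              ≡⟨ cong₂ (λ u v → c * (S₀ + S₃ + u) + c * v) gT≡0 (sym χ≡) ⟩
    c * (S₀ + S₃ + 0ℚ) + c * χ                      ≡⟨ cong (c * (S₀ + S₃ + 0ℚ) +_) cχ ⟩
    c * (S₀ + S₃ + 0ℚ) + linear-drop 2 2 α (β - α)  ≡⟨ closed α β T ⟩
    hit-right α β T                                 ∎
    where
    open ≡-Reasoning
    c S₀ S₃ : ℚ
    c = cycle-length α β
    S₀ = linear-drop 1ℚ 2 0ℚ (α - 0ℚ)
    S₃ = linear-drop 3 2 β (T - β)
    regroup : ∀ α β g₀ gA gB gT →
      cycle-length α β * g₀ ≡ cycle-length α β * ((g₀ - gA) + (gB - gT) + gT) + cycle-length α β * (gA - gB)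
    regroup = solve-∀ ringℚ
    closed : ∀ α β T →
      cycle-length α β * (linear-drop 1ℚ 2 0ℚ (α - 0ℚ) + linear-drop 3 2 β (T - β) + 0ℚ) + linear-drop 2 2 α (β - α)
      ≡ hit-right α β T
    closed = solve-∀ ringℚ
    spread : ∀ α β χ → cycle-length α β * χ ≡ χ + (β - α) * χ
    spread = solve-∀ ringℚ
    absorb : ∀ α β χ → linear-drop (2 - χ) 2 α (β - α) + (β - α) * χ ≡ linear-drop 2 2 α (β - α)
    absorb = solve-∀ ringℚ
    cχ : c * χ ≡ linear-drop 2 2 α (β - α)
    cχ = begin
      c * χ                                          ≡⟨ spread α β χ ⟩
      χ + (β - α) * χ                                ≡⟨ cong (_+ (β - α) * χ) (trans χ≡ d₁) ⟩
      linear-drop (2 - χ) 2 α (β - α) + (β - α) * χ  ≡⟨ absorb α β χ ⟩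
      linear-drop 2 2 α (β - α)                      ∎

  edge-value : ℚ → ℚ → Bool → Bool → Bool → ℚ → ℚ
  edge-value χ K iA iB iT P = (1ℚ + 2 * P) + 𝟙 iA * (1ℚ - χ) + 𝟙 iB * (1ℚ + χ) - 𝟙 iT * (2 * K)
  {-# INLINE edge-value #-}

  before-A : ∀ χ K P → edge-value χ K false false false P ≡ 1ℚ + 2 * P
  before-A = solve-∀ ringℚ

  on-cycle-before-target : ∀ χ K P → edge-value χ K true false false P ≡ (2 - χ) + 2 * P
  on-cycle-before-target = solve-∀ ringℚ

  on-cycle-after-target : ∀ χ K P → edge-value χ K true false true P ≡ (2 - χ - 2 * K) + 2 * P
  on-cycle-after-target = solve-∀ ringℚ

  after-B : ∀ χ K P → edge-value χ K true true false P ≡ 3 + 2 * P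
  after-B = solve-∀ ringℚ

  chord-kemeny-sum : ℚ → ℚ → ℚ → ℚ → ℚ → ℚ
  chord-kemeny-sum α ε β₀ β K₁ =
    2 * (∑quadratic 0ℚ 0ℚ (cycle-length α β) 0ℚ (1ℚ + α)
         + (∑quadratic (hit-cycle₀ α β (1ℚ + K₁)) (hit-cycle₁ α β (1ℚ + K₁)) (hit-cycle₂ α β (1ℚ + K₁))
                       (1ℚ + α) (1ℚ + ε)
            + ∑quadratic (hit-right₀ α β) (2 * cycle-length α β) (cycle-length α β) β (1ℚ + β₀)))
    - hit-left α β 0ℚ - hit-right α β K₁ + hit-left α β α + hit-right α β β
  {-# INLINE chord-kemeny-sum #-}

  module ChordWalk (a e b : ℕ) where

    A B km1 k : ℕ
    A   = a
    B   = suc a ℕ.+ suc e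
    km1 = a ℕ.+ (suc e ℕ.+ suc b)
    k   = suc km1

    A+2≤B : suc (suc A) ℕ.≤ B
    A+2≤B = s≤s (ℕ.≤-trans (s≤s (ℕ.m≤m+n a e)) (ℕ.≤-reflexive (sym (ℕ.+-suc a e))))

    B<k : B ℕ.< k
    B<k = ℕ.+-monoʳ-< (suc a) (ℕ.m<m+n (suc e) (s≤s z≤n))

    open ChordNeighbours A B k A+2≤B B<k public
    open RandomWalk {k} (chordE A B) (chordE-sym A B) chord-neighbour public

    α β K c : ℚ
    α = ⟦ A ⟧
    β = ⟦ B ⟧
    K = ⟦ k ⟧
    c = cycle-length α β

    ⟦B⟧≡ : β ≡ ⟦ a ⟧ + ⟦ suc (suc e) ⟧
    ⟦B⟧≡ = trans (cong ⟦_⟧ (sym (ℕ.+-suc a (suc e)))) (⟦⟧-+ a (suc (suc e)))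

    ⟦km1⟧≡ : ⟦ km1 ⟧ ≡ ⟦ a ⟧ + (⟦ suc e ⟧ + ⟦ suc b ⟧)
    ⟦km1⟧≡ = trans (⟦⟧-+ a (suc e ℕ.+ suc b)) (cong (⟦ a ⟧ +_) (⟦⟧-+ (suc e) (suc b)))

    c≡ : c ≡ ⟦ suc (suc (suc e)) ⟧
    c≡ = trans (cong (λ z → z - ⟦ a ⟧ + 1ℚ) ⟦B⟧≡) (shift ⟦ a ⟧ ⟦ e ⟧)
      where
      shift : ∀ x y → (x + (1ℚ + (1ℚ + y))) - x + 1ℚ ≡ 1ℚ + (1ℚ + (1ℚ + y))
      shift = solve-∀ ringℚ

    nbr∑≡ : ∀ q (f : ℕ → ℚ) → q ℕ.< k → nbr∑ q f ≡ (left q f + right k q f) + across A B q f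
    nbr∑≡ q f = ∑-chordE q f

    ∑-flux : ∀ (g : ℕ → ℚ) p → p ℕ.< k →
             ∑ (suc p) (λ q → nbr∑ q (δ g q)) ≡ right k p (δ g p) + (𝟙 (A <ᵇ suc p) - 𝟙 (B <ᵇ suc p)) * (g A - g B)
    ∑-flux g p p<k = begin
      ∑ (suc p) (λ q → nbr∑ q (δ g q))
        ≡⟨ ∑-cong (suc p) (λ q q≤p → nbr∑≡ q (δ g q) (ℕ.≤-<-trans (ℕ.≤-pred q≤p) p<k)) ⟩
      ∑ (suc p) (λ q → (left q (δ g q) + right k q (δ g q)) + across A B q (δ g q))
        ≡⟨ ∑-+ (suc p) (λ q → left q (δ g q) + right k q (δ g q)) (λ q → across A B q (δ g q)) ⟩
      ∑ (suc p) (λ q → left q (δ g q) + right k q (δ g q)) + ∑ (suc p) (λ q → across A B q (δ g q))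
        ≡⟨ cong₂ _+_ (∑-pathFlux k g p p<k) (∑-across A B (suc p) g) ⟩
      right k p (δ g p) + (𝟙 (A <ᵇ suc p) - 𝟙 (B <ᵇ suc p)) * (g A - g B) ∎
      where open ≡-Reasoning

    ∑deg : ∀ p → p ℕ.< k → ∑ (suc p) deg ≡ (⟦ p ⟧ + (⟦ p ⟧ + 𝟙 (suc p <ᵇ k))) + (𝟙 (A <ᵇ suc p) + 𝟙 (B <ᵇ suc p))
    ∑deg p p<k = begin
      ∑ (suc p) deg
        ≡⟨ ∑-cong (suc p) (λ q q≤p → nbr∑≡ q one (ℕ.≤-<-trans (ℕ.≤-pred q≤p) p<k)) ⟩
      ∑ (suc p) (λ q → (left q one + right k q one) + across A B q one)
        ≡⟨ ∑-+ (suc p) (λ q → left q one + right k q one) (λ q → across A B q one) ⟩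
      ∑ (suc p) (λ q → left q one + right k q one) + ∑ (suc p) (λ q → across A B q one)
        ≡⟨ cong (_+ ∑ (suc p) (λ q → across A B q one)) (∑-+ (suc p) (λ q → left q one) (λ q → right k q one)) ⟩
      (∑ (suc p) (λ q → left q one) + ∑ (suc p) (λ q → right k q one)) + ∑ (suc p) (λ q → across A B q one)
        ≡⟨ cong₂ _+_ (cong₂ _+_ (count-left p) (count-right k p p<k)) (count-across A B (suc p)) ⟩
      (⟦ p ⟧ + (⟦ p ⟧ + 𝟙 (suc p <ᵇ k))) + (𝟙 (A <ᵇ suc p) + 𝟙 (B <ᵇ suc p)) ∎
      where open ≡-Reasoning

    volume : ∑ k deg ≡ 2 * K
    volume = begin
      ∑ k deg
        ≡⟨ ∑deg km1 ℕ.≤-refl ⟩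
      (⟦ km1 ⟧ + (⟦ km1 ⟧ + 𝟙 (k <ᵇ k))) + (𝟙 (A <ᵇ k) + 𝟙 (B <ᵇ k))
        ≡⟨ cong₂ (λ x y → (⟦ km1 ⟧ + (⟦ km1 ⟧ + 𝟙 x)) + y)
          (<ᵇ-false {k} ℕ.≤-refl)
          (cong₂ (λ x y → 𝟙 x + 𝟙 y) (<ᵇ-true A<k) (<ᵇ-true B<k)) ⟩
      (⟦ km1 ⟧ + (⟦ km1 ⟧ + 0ℚ)) + (1ℚ + 1ℚ)
        ≡⟨ double ⟦ km1 ⟧ ⟩
      2 * K ∎
      where
      open ≡-Reasoning
      double : ∀ x → (x + (x + 0ℚ)) + (1ℚ + 1ℚ) ≡ 2 * (1ℚ + x)
      double = solve-∀ ringℚ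

    module ChordStationary (π : Fin k → ℚ) (stationary : IsStationary G π) where
      open Stationary π stationary public

      χ : ℚ
      χ = x A - x B

      drop : ∀ p → suc p ℕ.< k → x p - x (suc p) ≡ - ((𝟙 (A <ᵇ suc p) - 𝟙 (B <ᵇ suc p)) * χ)
      drop p p+1<k = trans (move-right (x p - x (suc p)) ((𝟙 (A <ᵇ suc p) - 𝟙 (B <ᵇ suc p)) * χ) 0ℚ (begin
        (x p - x (suc p)) + (𝟙 (A <ᵇ suc p) - 𝟙 (B <ᵇ suc p)) * χ
          ≡⟨ cong (_+ (𝟙 (A <ᵇ suc p) - 𝟙 (B <ᵇ suc p)) * χ) (sym (right-interior k x p p+1<k)) ⟩
        right k p (δ x p) + (𝟙 (A <ᵇ suc p) - 𝟙 (B <ᵇ suc p)) * χ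
          ≡⟨ sym (∑-flux x p p<k) ⟩
        ∑ (suc p) (λ q → nbr∑ q (δ x q))
          ≡⟨ ∑-cong (suc p) (λ q q≤p → x-harmonic q (ℕ.≤-<-trans (ℕ.≤-pred q≤p) p<k)) ⟩
        ∑ (suc p) (λ _ → 0ℚ)
          ≡⟨ ∑-0 (suc p) ⟩
        0ℚ ∎)) (+-identityˡ _)
        where
        open ≡-Reasoning
        p<k : p ℕ.< k
        p<k = ℕ.<-trans (ℕ.n<1+n p) p+1<k

      χ≡0 : χ ≡ 0ℚ
      χ≡0 = ⟦suc⟧*x≡0⇒x≡0 (suc (suc e)) χ (begin
        ⟦ suc (suc (suc e)) ⟧ * χ               ≡⟨ cong (λ z → (1ℚ + z) * χ) (sym N≡) ⟩
        (1ℚ + N) * χ                            ≡⟨ split-off N χ ⟩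
        χ + N * χ                               ≡⟨ cong (_+ N * χ) around-the-cycle ⟩
        linear-drop (- χ) 0ℚ ⟦ A ⟧ N + N * χ    ≡⟨ drop-cancels N χ ⟦ A ⟧ ⟩
        0ℚ                                      ∎)
        where
        open ≡-Reasoning
        N : ℚ
        N = β - α
        split-off : ∀ N χ → (1ℚ + N) * χ ≡ χ + N * χ
        split-off = solve-∀ ringℚ
        drop-cancels : ∀ N χ α → linear-drop (- χ) 0ℚ α N + N * χ ≡ 0ℚ
        drop-cancels = solve-∀ ringℚ
        cancel : ∀ x y → (x + y) - x ≡ y
        cancel = solve-∀ ringℚ
        N≡ : N ≡ ⟦ suc (suc e) ⟧
        N≡ = trans (cong (_- ⟦ a ⟧) ⟦B⟧≡) (cancel ⟦ a ⟧ ⟦ suc (suc e) ⟧)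
        only-A : ∀ χ P → - ((1ℚ - 0ℚ) * χ) ≡ - χ + 0ℚ * P
        only-A = solve-∀ ringℚ
        on-cycle : ∀ p → A ℕ.≤ p → p ℕ.< B → x p - x (suc p) ≡ - χ + 0ℚ * ⟦ p ⟧
        on-cycle p A≤p p<B = begin
          x p - x (suc p)
            ≡⟨ drop p (ℕ.≤-<-trans p<B B<k) ⟩
          - ((𝟙 (A <ᵇ suc p) - 𝟙 (B <ᵇ suc p)) * χ)
            ≡⟨ cong₂ (λ u v → - ((𝟙 u - 𝟙 v) * χ)) (<ᵇ-true (s≤s A≤p)) (<ᵇ-false p<B) ⟩
          - ((1ℚ - 0ℚ) * χ)
            ≡⟨ only-A χ ⟦ p ⟧ ⟩
          - χ + 0ℚ * ⟦ p ⟧ ∎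
        around-the-cycle : χ ≡ linear-drop (- χ) 0ℚ ⟦ A ⟧ N
        around-the-cycle = drop-linear A B (- χ) 0ℚ x (ℕ.<⇒≤ A<B) on-cycle

      x-constant : ∀ q → q ℕ.< k → x q ≡ x 0
      x-constant = zero-drops⇒constant k x drop≡0
        where
        vanish : ∀ y → - (y * 0ℚ) ≡ 0ℚ
        vanish = solve-∀ ringℚ
        drop≡0 : ∀ p → suc p ℕ.< k → x p - x (suc p) ≡ 0ℚ
        drop≡0 p p+1<k =
          trans (drop p p+1<k)
                (trans (cong (λ z → - ((𝟙 (A <ᵇ suc p) - 𝟙 (B <ᵇ suc p)) * z)) χ≡0)
                       (vanish (𝟙 (A <ᵇ suc p) - 𝟙 (B <ᵇ suc p))))

    module ChordHitting (m : Fin k → Fin k → ℚ) (mfpt : IsMFPT G m) (t : Fin k) where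
      open Hitting m mfpt t

      T : ℕ
      T = toℕ t

      T<k : T ℕ.< k
      T<k = Fin.toℕ<n t

      χ D : ℚ
      χ = h A - h B
      D = nbr∑ T (δ h T) - deg T

      prefix : ∀ p → p ℕ.< k →
               right k p (δ h p) + (𝟙 (A <ᵇ suc p) - 𝟙 (B <ᵇ suc p)) * χ ≡ ∑ (suc p) deg + 𝟙 (T <ᵇ suc p) * D
      prefix p p<k = trans (sym (∑-flux h p p<k))
                           (∑-update (suc p) T (λ q → nbr∑ q (δ h q)) deg
                                     (λ q q≤p → hitting-equation q (ℕ.≤-<-trans (ℕ.≤-pred q≤p) p<k)))

      -- The first-step equations fail only at the target, by D; the cut after the last vertex, across
      -- which nothing flows, identifies D.
      defect : D ≡ - (2 * K)
      defect = isolate (h km1 - h k) χ (2 * K) D (begin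
        0ℚ * (h km1 - h k) + (1ℚ - 1ℚ) * χ
          ≡⟨ cong₂ (λ u v → 𝟙 u * (h km1 - h k) + (𝟙 v - 1ℚ) * χ)
            (sym (<ᵇ-false {k} ℕ.≤-refl)) (sym (<ᵇ-true A<k)) ⟩
        right k km1 (δ h km1) + (𝟙 (A <ᵇ k) - 1ℚ) * χ
          ≡⟨ cong (λ v → right k km1 (δ h km1) + (𝟙 (A <ᵇ k) - 𝟙 v) * χ)
            (sym (<ᵇ-true B<k)) ⟩
        right k km1 (δ h km1) + (𝟙 (A <ᵇ k) - 𝟙 (B <ᵇ k)) * χ
          ≡⟨ prefix km1 ℕ.≤-refl ⟩
        ∑ k deg + 𝟙 (T <ᵇ k) * D
          ≡⟨ cong₂ (λ u v → u + 𝟙 v * D) volume (<ᵇ-true T<k) ⟩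
        2 * K + 1ℚ * D ∎)
        where
        open ≡-Reasoning
        solve₁ : ∀ V D → D ≡ (V + 1ℚ * D) - V
        solve₁ = solve-∀ ringℚ
        solve₂ : ∀ d χ V → (0ℚ * d + (1ℚ - 1ℚ) * χ) - V ≡ - V
        solve₂ = solve-∀ ringℚ
        isolate : ∀ d χ V D → 0ℚ * d + (1ℚ - 1ℚ) * χ ≡ V + 1ℚ * D → D ≡ - V
        isolate d χ V D eq = trans (solve₁ V D) (trans (cong (_- V) (sym eq)) (solve₂ d χ V))

      drop : ∀ p → suc p ℕ.< k → h p - h (suc p) ≡ edge-value χ K (A <ᵇ suc p) (B <ᵇ suc p) (T <ᵇ suc p) ⟦ p ⟧
      drop p p+1<k = begin
        h p - h (suc p)
          ≡⟨ move-right _ _ _ cut ⟩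
        (∑ (suc p) deg + iT * D) - (iA - iB) * χ
          ≡⟨ cong₂ (λ u v → (u + iT * v) - (iA - iB) * χ) (∑deg p p<k) defect ⟩
        ((⟦ p ⟧ + (⟦ p ⟧ + 𝟙 (suc p <ᵇ k))) + (iA + iB)) + iT * - (2 * K) - (iA - iB) * χ
          ≡⟨ cong (λ u → ((⟦ p ⟧ + (⟦ p ⟧ + 𝟙 u)) + (iA + iB)) + iT * - (2 * K) - (iA - iB) * χ) (<ᵇ-true p+1<k) ⟩
        ((⟦ p ⟧ + (⟦ p ⟧ + 1ℚ)) + (iA + iB)) + iT * - (2 * K) - (iA - iB) * χ
          ≡⟨ collect iA iB iT ⟦ p ⟧ χ K ⟩
        edge-value χ K (A <ᵇ suc p) (B <ᵇ suc p) (T <ᵇ suc p) ⟦ p ⟧ ∎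
        where
        open ≡-Reasoning
        p<k : p ℕ.< k
        p<k = ℕ.<-trans (ℕ.n<1+n p) p+1<k
        iA iB iT : ℚ
        iA = 𝟙 (A <ᵇ suc p)
        iB = 𝟙 (B <ᵇ suc p)
        iT = 𝟙 (T <ᵇ suc p)
        cut : (h p - h (suc p)) + (iA - iB) * χ ≡ ∑ (suc p) deg + iT * D
        cut = trans (cong (_+ (iA - iB) * χ) (sym (right-interior k h p p+1<k))) (prefix p p<k)
        collect : ∀ a b t P χ K → ((P + (P + 1ℚ)) + (a + b)) + t * - (2 * K) - (a - b) * χ
                                ≡ (1ℚ + 2 * P) + a * (1ℚ - χ) + b * (1ℚ + χ) - t * (2 * K)
        collect = solve-∀ ringℚ

      range : ∀ lo hi iA iB iT u → lo ℕ.≤ hi → hi ℕ.< k →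
              (∀ p → lo ℕ.≤ p → p ℕ.< hi → (A <ᵇ suc p) ≡ iA × (B <ᵇ suc p) ≡ iB × (T <ᵇ suc p) ≡ iT) →
              (∀ P → edge-value χ K iA iB iT P ≡ u + 2 * P) →
              h lo - h hi ≡ linear-drop u 2 ⟦ lo ⟧ (⟦ hi ⟧ - ⟦ lo ⟧)
      range lo hi iA iB iT u lo≤hi hi<k indicators value = drop-linear lo hi u 2 h lo≤hi drop-in-range
        where
        known : ∀ p → suc p ℕ.< k → (A <ᵇ suc p) ≡ iA → (B <ᵇ suc p) ≡ iB → (T <ᵇ suc p) ≡ iT →
                h p - h (suc p) ≡ edge-value χ K iA iB iT ⟦ p ⟧
        known p p+1<k refl refl refl = drop p p+1<k
        drop-in-range : ∀ p → lo ℕ.≤ p → p ℕ.< hi → h p - h (suc p) ≡ u + 2 * ⟦ p ⟧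
        drop-in-range p lo≤p p<hi with indicators p lo≤p p<hi
        ... | eA , eB , eT = trans (known p (ℕ.≤-<-trans p<hi hi<k) eA eB eT) (value ⟦ p ⟧)

      passed : ∀ {X p} → X ℕ.≤ p → (X <ᵇ suc p) ≡ true
      passed X≤p = <ᵇ-true (s≤s X≤p)

      ahead : ∀ {X p} → p ℕ.< X → (X <ᵇ suc p) ≡ false
      ahead p<X = <ᵇ-false p<X

      to-A : A ℕ.< T → h 0 - h A ≡ linear-drop 1ℚ 2 0ℚ (α - 0ℚ)
      to-A A<T = range 0 A false false false 1ℚ z≤n A<k
                   (λ p _ p<A → ahead p<A , ahead (ℕ.<-trans p<A A<B) , ahead (ℕ.<-trans p<A A<T))
                   (before-A χ K)

      hitting-left : Fin.zero ≢ t → T ℕ.≤ A → c * m Fin.zero t ≡ hit-left α β ⟦ T ⟧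
      hitting-left 0≢t T≤A = begin
        c * m Fin.zero t
          ≡⟨ cong (c *_) (sym (h-start Fin.zero 0≢t)) ⟩
        c * h 0
          ≡⟨ cong (c *_) (sym (trans (cong (λ z → h 0 - z) h-target) (+-identityʳ (h 0)))) ⟩
        c * (h 0 - h T)
          ≡⟨ cong (c *_) to-T ⟩
        c * linear-drop 1ℚ 2 0ℚ (⟦ T ⟧ - 0ℚ)
          ≡⟨ square α β ⟦ T ⟧ ⟩
        hit-left α β ⟦ T ⟧ ∎
        where
        open ≡-Reasoning
        square : ∀ α β T → cycle-length α β * linear-drop 1ℚ 2 0ℚ (T - 0ℚ) ≡ hit-left α β T
        square = solve-∀ ringℚ
        to-T : h 0 - h T ≡ linear-drop 1ℚ 2 0ℚ (⟦ T ⟧ - 0ℚ)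
        to-T = range 0 T false false false 1ℚ z≤n T<k
                 (λ p _ p<T → ahead (ℕ.<-≤-trans p<T T≤A) , ahead (ℕ.<-≤-trans p<T (ℕ.≤-trans T≤A (ℕ.<⇒≤ A<B)))
                            , ahead p<T)
                 (before-A χ K)

      hitting-cycle : Fin.zero ≢ t → A ℕ.< T → T ℕ.< B → c * m Fin.zero t ≡ hit-cycle α β K ⟦ T ⟧
      hitting-cycle 0≢t A<T T<B =
        trans (cong (c *_) (sym (h-start Fin.zero 0≢t)))
              (solve-cycle α β K ⟦ T ⟧ χ (h 0) (h A) (h T) (h B) (to-A A<T) A-to-T T-to-B h-target refl)
        where
        A-to-T : h A - h T ≡ linear-drop (2 - χ) 2 α (⟦ T ⟧ - α)
        A-to-T = range A T true false false (2 - χ) (ℕ.<⇒≤ A<T) T<k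
                   (λ p A≤p p<T → passed A≤p , ahead (ℕ.<-trans p<T T<B) , ahead p<T)
                   (on-cycle-before-target χ K)
        T-to-B : h T - h B ≡ linear-drop (2 - χ - 2 * K) 2 ⟦ T ⟧ (β - ⟦ T ⟧)
        T-to-B = range T B true false true (2 - χ - 2 * K) (ℕ.<⇒≤ T<B) B<k
                   (λ p T≤p p<B → passed (ℕ.≤-trans (ℕ.<⇒≤ A<T) T≤p) , ahead p<B , passed T≤p)
                   (on-cycle-after-target χ K)

      hitting-right : Fin.zero ≢ t → B ℕ.≤ T → c * m Fin.zero t ≡ hit-right α β ⟦ T ⟧
      hitting-right 0≢t B≤T =
        trans (cong (c *_) (sym (h-start Fin.zero 0≢t)))
              (solve-right α β ⟦ T ⟧ χ (h 0) (h A) (h B) (h T) (to-A A<T) A-to-B B-to-T h-target refl)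
        where
        A<T : A ℕ.< T
        A<T = ℕ.<-≤-trans A<B B≤T
        A-to-B : h A - h B ≡ linear-drop (2 - χ) 2 α (β - α)
        A-to-B = range A B true false false (2 - χ) (ℕ.<⇒≤ A<B) B<k
                   (λ p A≤p p<B → passed A≤p , ahead p<B , ahead (ℕ.<-≤-trans p<B B≤T))
                   (on-cycle-before-target χ K)
        B-to-T : h B - h T ≡ linear-drop 3 2 β (⟦ T ⟧ - β)
        B-to-T = range B T true true false 3 B≤T T<k
                   (λ p B≤p p<T → passed (ℕ.≤-trans (ℕ.<⇒≤ A<B) B≤p) , passed B≤p , ahead p<T)
                   (after-B χ K)

    scaled-hitting : ℕ → ℚ
    scaled-hitting q =
      if q <ᵇ suc A then hit-left α β ⟦ q ⟧
      else if q <ᵇ B then hit-cycle α β K ⟦ q ⟧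
      else hit-right α β ⟦ q ⟧

    scaled-left : ∀ q → q ℕ.≤ A → scaled-hitting q ≡ hit-left α β ⟦ q ⟧
    scaled-left q q≤A rewrite <ᵇ-true (s≤s q≤A) = refl

    scaled-cycle : ∀ q → A ℕ.< q → q ℕ.< B → scaled-hitting q ≡ hit-cycle α β K ⟦ q ⟧
    scaled-cycle q A<q q<B rewrite <ᵇ-false {q} {suc A} A<q | <ᵇ-true q<B = refl

    scaled-right : ∀ q → B ℕ.≤ q → scaled-hitting q ≡ hit-right α β ⟦ q ⟧
    scaled-right q B≤q rewrite <ᵇ-false {q} {suc A} (ℕ.<-≤-trans A<B B≤q) | <ᵇ-false {q} {B} B≤q = refl

    scaled-hitting-time : (m : Fin k → Fin k → ℚ) → IsMFPT G m → ∀ t → Fin.zero ≢ t →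
                          c * m Fin.zero t ≡ scaled-hitting (toℕ t)
    scaled-hitting-time m mfpt t 0≢t with toℕ t ℕ.≤? A | toℕ t ℕ.<? B
    ... | yes T≤A | _       = trans (hitting-left 0≢t T≤A) (sym (scaled-left (toℕ t) T≤A))
      where open ChordHitting m mfpt t
    ... | no  T≰A | yes T<B = trans (hitting-cycle 0≢t (ℕ.≰⇒> T≰A) T<B) (sym (scaled-cycle (toℕ t) (ℕ.≰⇒> T≰A) T<B))
      where open ChordHitting m mfpt t
    ... | no  _   | no  T≮B = trans (hitting-right 0≢t (ℕ.≮⇒≥ T≮B)) (sym (scaled-right (toℕ t) (ℕ.≮⇒≥ T≮B)))
      where open ChordHitting m mfpt t

    ∑deg* : ∀ (f : ℕ → ℚ) → ∑ k (λ q → deg q * f q) ≡ 2 * ∑ k f - f 0 - f km1 + f A + f B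
    ∑deg* f = begin
      ∑ k (λ q → deg q * f q)
        ≡⟨ ∑-cong k (λ q q<k → trans (cong (_* f q) (nbr∑≡ q one q<k))
                                     (spread (left q one) (right k q one) (across A B q one) (f q))) ⟩
      ∑ k (λ q → (left q one * f q + right k q one * f q) + across A B q one * f q)
        ≡⟨ ∑-+ k (λ q → left q one * f q + right k q one * f q) (λ q → across A B q one * f q) ⟩
      ∑ k (λ q → left q one * f q + right k q one * f q) + ∑ k (λ q → across A B q one * f q)
        ≡⟨ cong₂ _+_ (∑-+ k (λ q → left q one * f q) (λ q → right k q one * f q)) endpoints ⟩
      (∑ k (λ q → left q one * f q) + ∑ k (λ q → right k q one * f q)) + (f A + f B)
        ≡⟨ cong (_+ (f A + f B)) (cong₂ _+_ (∑-left* km1 f) (∑-right* km1 f)) ⟩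
      (∑ km1 (λ q → f (suc q)) + ∑ km1 f) + (f A + f B)
        ≡⟨ double-count (f 0) (∑ km1 (λ q → f (suc q))) (∑ km1 f) (f km1) (f A) (f B) (∑-last km1 f) ⟩
      2 * ∑ k f - f 0 - f km1 + f A + f B ∎
      where
      open ≡-Reasoning
      spread : ∀ l r a x → ((l + r) + a) * x ≡ (l * x + r * x) + a * x
      spread = solve-∀ ringℚ
      regroup : ∀ f₀ X Y fₙ fA fB → (X + Y) + (fA + fB) ≡ (f₀ + X) + (Y + fₙ) - f₀ - fₙ + fA + fB
      regroup = solve-∀ ringℚ
      double : ∀ S f₀ fₙ fA fB → S + S - f₀ - fₙ + fA + fB ≡ 2 * S - f₀ - fₙ + fA + fB
      double = solve-∀ ringℚ
      double-count : ∀ f₀ X Y fₙ fA fB → f₀ + X ≡ Y + fₙ →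
                     (X + Y) + (fA + fB) ≡ 2 * (f₀ + X) - f₀ - fₙ + fA + fB
      double-count f₀ X Y fₙ fA fB S≡ =
        trans (regroup f₀ X Y fₙ fA fB)
              (trans (cong (λ z → (f₀ + X) + z - f₀ - fₙ + fA + fB) (sym S≡)) (double (f₀ + X) f₀ fₙ fA fB))
      split : ∀ a b x → (a * 1ℚ + b * 1ℚ) * x ≡ a * x + b * x
      split = solve-∀ ringℚ
      endpoints : ∑ k (λ q → across A B q one * f q) ≡ f A + f B
      endpoints = begin
        ∑ k (λ q → across A B q one * f q)                          ≡⟨ ∑-cong k (λ q _ → split (𝟙 (q ≡ᵇ A)) (𝟙 (q ≡ᵇ B)) (f q)) ⟩
        ∑ k (λ q → 𝟙 (q ≡ᵇ A) * f q + 𝟙 (q ≡ᵇ B) * f q)              ≡⟨ ∑-+ k (λ q → 𝟙 (q ≡ᵇ A) * f q) (λ q → 𝟙 (q ≡ᵇ B) * f q) ⟩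
        ∑ k (λ q → 𝟙 (q ≡ᵇ A) * f q) + ∑ k (λ q → 𝟙 (q ≡ᵇ B) * f q)  ≡⟨ cong₂ _+_ (∑-δ k A f) (∑-δ k B f) ⟩
        𝟙 (A <ᵇ k) * f A + 𝟙 (B <ᵇ k) * f B                          ≡⟨ cong₂ (λ u v → 𝟙 u * f A + 𝟙 v * f B) (<ᵇ-true A<k) (<ᵇ-true B<k) ⟩
        1ℚ * f A + 1ℚ * f B                                          ≡⟨ cong₂ _+_ (*-identityˡ (f A)) (*-identityˡ (f B)) ⟩
        f A + f B                                                    ∎

    ∑-scaled-hitting :
      ∑ k scaled-hitting ≡
        ∑quadratic 0ℚ 0ℚ c 0ℚ ⟦ suc a ⟧
        + (∑quadratic (hit-cycle₀ α β K) (hit-cycle₁ α β K) (hit-cycle₂ α β K) ⟦ suc a ⟧ ⟦ suc e ⟧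
           + ∑quadratic (hit-right₀ α β) (2 * c) c β ⟦ suc b ⟧)
    ∑-scaled-hitting = begin
      ∑ k scaled-hitting
        ≡⟨ ∑-split (suc a) (suc e ℕ.+ suc b) scaled-hitting ⟩
      ∑ (suc a) scaled-hitting + ∑ (suc e ℕ.+ suc b) (λ q → scaled-hitting (suc a ℕ.+ q))
        ≡⟨ cong (∑ (suc a) scaled-hitting +_) (∑-split (suc e) (suc b) (λ q → scaled-hitting (suc a ℕ.+ q))) ⟩
      ∑ (suc a) scaled-hitting
        + (∑ (suc e) (λ q → scaled-hitting (suc a ℕ.+ q)) + ∑ (suc b) (λ q → scaled-hitting (suc a ℕ.+ (suc e ℕ.+ q))))
        ≡⟨ cong₂ _+_ left-part (cong₂ _+_ cycle-part right-part) ⟩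
      _ ∎
      where
      open ≡-Reasoning
      left-part : ∑ (suc a) scaled-hitting ≡ ∑quadratic 0ℚ 0ℚ c 0ℚ ⟦ suc a ⟧
      left-part =
        trans (∑-cong (suc a) (λ q q≤A → trans (scaled-left q (ℕ.≤-pred q≤A)) (hit-left-quadratic α β ⟦ q ⟧)))
              (∑-quadratic (suc a) 0 0ℚ 0ℚ c)
      cycle-part : ∑ (suc e) (λ q → scaled-hitting (suc a ℕ.+ q))
                   ≡ ∑quadratic (hit-cycle₀ α β K) (hit-cycle₁ α β K) (hit-cycle₂ α β K) ⟦ suc a ⟧ ⟦ suc e ⟧
      cycle-part =
        trans (∑-cong (suc e) (λ q q≤e → trans (scaled-cycle (suc a ℕ.+ q) (s≤s (ℕ.m≤m+n a q)) (ℕ.+-monoʳ-< (suc a) q≤e))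
                                               (hit-cycle-quadratic α β K ⟦ suc a ℕ.+ q ⟧)))
              (∑-quadratic (suc e) (suc a) (hit-cycle₀ α β K) (hit-cycle₁ α β K) (hit-cycle₂ α β K))
      right-part : ∑ (suc b) (λ q → scaled-hitting (suc a ℕ.+ (suc e ℕ.+ q))) ≡ ∑quadratic (hit-right₀ α β) (2 * c) c β ⟦ suc b ⟧
      right-part =
        trans (∑-cong (suc b) (λ q _ → trans (cong scaled-hitting (sym (ℕ.+-assoc (suc a) (suc e) q)))
                                             (trans (scaled-right (B ℕ.+ q) (ℕ.m≤m+n B q))
                                                    (hit-right-quadratic α β ⟦ B ℕ.+ q ⟧))))
              (∑-quadratic (suc b) B (hit-right₀ α β) (2 * c) c)

    scaled-kemeny : ∀ κ → IsKemeny G κ → (2 * K * c) * κ ≡ ∑ k (λ q → deg q * scaled-hitting q)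
    scaled-kemeny κ (π , m , stationary , mfpt , kemeny) = begin
      (2 * K * c) * κ
        ≡⟨ cong ((2 * K * c) *_) (kemeny Fin.zero) ⟩
      (2 * K * c) * _
        ≡⟨ cong ((2 * K * c) *_) (kemeny-sum π m Fin.zero H x₀ refl H0≡0 m≡H π≡) ⟩
      (2 * K * c) * ∑ k (λ q → H q * (deg q * x₀))
        ≡⟨ cong ((2 * K * c) *_) (∑-cong k (λ q _ → rearrange ic (scaled-hitting q) (deg q) x₀)) ⟩
      (2 * K * c) * ∑ k (λ q → (x₀ * ic) * (deg q * scaled-hitting q))
        ≡⟨ cong ((2 * K * c) *_) (∑-*ˡ k (x₀ * ic) (λ q → deg q * scaled-hitting q)) ⟩
      (2 * K * c) * ((x₀ * ic) * S)
        ≡⟨ regroup K c x₀ ic S ⟩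
      ((2 * K) * x₀) * (c * ic) * S
        ≡⟨ cong₂ (λ u v → u * v * S) mass c*ic ⟩
      1ℚ * 1ℚ * S
        ≡⟨ trans (cong (_* S) (*-identityˡ 1ℚ)) (*-identityˡ S) ⟩
      S ∎
      where
      open ≡-Reasoning
      open ChordStationary π stationary
      x₀ ic S : ℚ
      x₀ = x 0
      ic = inv (suc (suc (suc e)))
      S = ∑ k (λ q → deg q * scaled-hitting q)
      H : ℕ → ℚ
      H q = ic * scaled-hitting q
      c*ic : c * ic ≡ 1ℚ
      c*ic = trans (cong (_* ic) c≡) (⟦suc⟧*inv (suc (suc e)))
      π≡ : ∀ j → π j ≡ deg (toℕ j) * x₀
      π≡ j = trans (π≡deg*x j) (cong (deg (toℕ j) *_) (x-constant (toℕ j) (Fin.toℕ<n j)))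
      mass : (2 * K) * x₀ ≡ 1ℚ
      mass = trans (cong (_* x₀) (sym volume)) (total-mass π x₀ (proj₁ (proj₂ stationary)) π≡)
      vanish : ∀ i α β → i * hit-left α β 0ℚ ≡ 0ℚ
      vanish = solve-∀ ringℚ
      H0≡0 : H 0 ≡ 0ℚ
      H0≡0 = trans (cong (ic *_) (scaled-left 0 z≤n)) (vanish ic α β)
      swap : ∀ a b x → (a * b) * x ≡ b * (a * x)
      swap = solve-∀ ringℚ
      m≡H : ∀ j → toℕ j ≢ 0 → m Fin.zero j ≡ H (toℕ j)
      m≡H j j≢0 = begin
        m Fin.zero j             ≡⟨ sym (*-identityˡ _) ⟩
        1ℚ * m Fin.zero j        ≡⟨ cong (_* m Fin.zero j) (sym c*ic) ⟩
        (c * ic) * m Fin.zero j  ≡⟨ swap c ic (m Fin.zero j) ⟩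
        ic * (c * m Fin.zero j)  ≡⟨ cong (ic *_) (scaled-hitting-time m mfpt j (λ 0≡j → j≢0 (sym (cong toℕ 0≡j)))) ⟩
        H (toℕ j)                ∎
      rearrange : ∀ i s d x → (i * s) * (d * x) ≡ (x * i) * (d * s)
      rearrange = solve-∀ ringℚ
      regroup : ∀ K c x i S → (2 * K * c) * ((x * i) * S) ≡ ((2 * K) * x) * (c * i) * S
      regroup = solve-∀ ringℚ

    chord-kemeny : ∀ κ → IsKemeny G κ → (2 * K * c) * κ ≡ chord-kemeny-sum ⟦ a ⟧ ⟦ e ⟧ ⟦ b ⟧ β ⟦ km1 ⟧
    chord-kemeny κ chord-κ = begin
      (2 * K * c) * κ
        ≡⟨ scaled-kemeny κ chord-κ ⟩
      ∑ k (λ q → deg q * scaled-hitting q)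
        ≡⟨ ∑deg* scaled-hitting ⟩
      2 * ∑ k scaled-hitting - scaled-hitting 0 - scaled-hitting km1 + scaled-hitting A + scaled-hitting B
        ≡⟨ combine ∑-scaled-hitting (scaled-left 0 z≤n) (scaled-right km1 (ℕ.≤-pred B<k))
                   (scaled-left A ℕ.≤-refl) (scaled-right B ℕ.≤-refl) ⟩
      chord-kemeny-sum ⟦ a ⟧ ⟦ e ⟧ ⟦ b ⟧ β ⟦ km1 ⟧ ∎
      where
      open ≡-Reasoning
      combine : ∀ {S S′ x x′ y y′ z z′ w w′} → S ≡ S′ → x ≡ x′ → y ≡ y′ → z ≡ z′ → w ≡ w′ →
                2 * S - x - y + z + w ≡ 2 * S′ - x′ - y′ + z′ + w′
      combine refl refl refl refl refl = refl

  -- Comparison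

  kemeny-gap-poly : ℚ → ℚ → ℚ → ℚ → ℚ → ℚ
  kemeny-gap-poly α ε β μ ν =
    2 * ((3 + ε) * (3 + ε)) * ((1ℚ + ε) * (1ℚ + ε))
    + 8 * (3 + ε) * ((α + β) * (2 + ε) * (1ℚ + ε) + α * μ + β * ν)
    + 8 * α * β * (9 + 11 * ε + 3 * ε * ε)
  {-# INLINE kemeny-gap-poly #-}

  kemeny-gap-poly-positive : ∀ a e b u v → 0ℚ < kemeny-gap-poly ⟦ a ⟧ ⟦ e ⟧ ⟦ b ⟧ ⟦ u ⟧ ⟦ v ⟧
  kemeny-gap-poly-positive a e b u v = 0<+ (0<+ first second) third
    where
    ε : ℚ
    ε = ⟦ e ⟧
    0≤α : 0ℚ ≤ ⟦ a ⟧
    0≤α = 0≤⟦ a ⟧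
    0≤ε : 0ℚ ≤ ε
    0≤ε = 0≤⟦ e ⟧
    0≤β : 0ℚ ≤ ⟦ b ⟧
    0≤β = 0≤⟦ b ⟧
    0<3+ε : 0ℚ < 3 + ε
    0<3+ε = 0<+ (positive⁻¹ 3) 0≤ε
    0<1+ε : 0ℚ < 1ℚ + ε
    0<1+ε = 0<+ (positive⁻¹ 1ℚ) 0≤ε
    first : 0ℚ < 2 * ((3 + ε) * (3 + ε)) * ((1ℚ + ε) * (1ℚ + ε))
    first = 0<* (0<* (positive⁻¹ 2) (0<* 0<3+ε 0<3+ε)) (0<* 0<1+ε 0<1+ε)
    second : 0ℚ ≤ 8 * (3 + ε) * ((⟦ a ⟧ + ⟦ b ⟧) * (2 + ε) * (1ℚ + ε) + ⟦ a ⟧ * ⟦ u ⟧ + ⟦ b ⟧ * ⟦ v ⟧)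
    second = 0≤* (0≤* (nonNegative⁻¹ 8) (<⇒≤ 0<3+ε))
                 (0≤+ (0≤+ (0≤* (0≤* (0≤+ 0≤α 0≤β) (0≤+ (nonNegative⁻¹ 2) 0≤ε)) (<⇒≤ 0<1+ε)) (0≤* 0≤α 0≤⟦ u ⟧))
                      (0≤* 0≤β 0≤⟦ v ⟧))
    third : 0ℚ ≤ 8 * ⟦ a ⟧ * ⟦ b ⟧ * (9 + 11 * ε + 3 * ε * ε)
    third = 0≤* (0≤* (0≤* (nonNegative⁻¹ 8) 0≤α) 0≤β)
                (0≤+ (0≤+ (nonNegative⁻¹ 9) (0≤* (nonNegative⁻¹ 11) 0≤ε)) (0≤* (0≤* (nonNegative⁻¹ 3) 0≤ε) 0≤ε))

  kemeny-gap : ∀ α ε β₀ β K₁ μ ν κC κP →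
               β ≡ α + (1ℚ + (1ℚ + ε)) → K₁ ≡ α + ((1ℚ + ε) + (1ℚ + β₀)) →
               μ ≡ ((1ℚ + (1ℚ + ε)) + β₀) - α → ν ≡ ((1ℚ + (1ℚ + ε)) + α) - β₀ →
               (2 * (1ℚ + K₁) * cycle-length α β) * κC ≡ chord-kemeny-sum α ε β₀ β K₁ →
               κP ≡ κ-path (1ℚ + K₁) →
               (κC - κP) * (12 * (1ℚ + K₁) * cycle-length α β) ≡ - kemeny-gap-poly α ε β₀ μ ν
  kemeny-gap α ε β₀ β K₁ μ ν κC κP refl refl refl refl chord path = begin
    (κC - κP) * (12 * K * c)                                   ≡⟨ expand K c κC κP ⟩
    6 * ((2 * K * c) * κC) - 12 * K * c * κP                   ≡⟨ cong₂ (λ u v → 6 * u - 12 * K * c * v) chord path ⟩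
    6 * chord-kemeny-sum α ε β₀ β K₁ - 12 * K * c * κ-path K   ≡⟨ closed-form α ε β₀ ⟩
    - kemeny-gap-poly α ε β₀ μ ν                               ∎
    where
    open ≡-Reasoning
    K c : ℚ
    K = 1ℚ + K₁
    c = cycle-length α β
    expand : ∀ K c κC κP → (κC - κP) * (12 * K * c) ≡ 6 * ((2 * K * c) * κC) - 12 * K * c * κP
    expand = solve-∀ ringℚ
    closed-form : ∀ α ε β₀ →
      6 * chord-kemeny-sum α ε β₀ (α + (1ℚ + (1ℚ + ε))) (α + ((1ℚ + ε) + (1ℚ + β₀)))
        - 12 * (1ℚ + (α + ((1ℚ + ε) + (1ℚ + β₀)))) * cycle-length α (α + (1ℚ + (1ℚ + ε)))
             * κ-path (1ℚ + (α + ((1ℚ + ε) + (1ℚ + β₀))))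
      ≡ - kemeny-gap-poly α ε β₀ (((1ℚ + (1ℚ + ε)) + β₀) - α) (((1ℚ + (1ℚ + ε)) + α) - β₀)
    closed-form = solve-∀ ringℚ

  ⌈n/2⌉+⌈n/2⌉≤1+n : ∀ n → ⌈ n /2⌉ ℕ.+ ⌈ n /2⌉ ℕ.≤ suc n
  ⌈n/2⌉+⌈n/2⌉≤1+n zero          = z≤n
  ⌈n/2⌉+⌈n/2⌉≤1+n (suc zero)    = ℕ.≤-refl
  ⌈n/2⌉+⌈n/2⌉≤1+n (suc (suc n)) =
    s≤s (subst (ℕ._≤ suc (suc n)) (sym (ℕ.+-suc ⌈ n /2⌉ ⌈ n /2⌉)) (s≤s (⌈n/2⌉+⌈n/2⌉≤1+n n)))

  n≤⌈n/2⌉+⌈n/2⌉ : ∀ n → n ℕ.≤ ⌈ n /2⌉ ℕ.+ ⌈ n /2⌉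
  n≤⌈n/2⌉+⌈n/2⌉ zero          = z≤n
  n≤⌈n/2⌉+⌈n/2⌉ (suc zero)    = s≤s z≤n
  n≤⌈n/2⌉+⌈n/2⌉ (suc (suc n)) =
    s≤s (subst (suc n ℕ.≤_) (sym (ℕ.+-suc ⌈ n /2⌉ ⌈ n /2⌉)) (s≤s (n≤⌈n/2⌉+⌈n/2⌉ n)))

  module Comparison (a e b : ℕ) where
    open ChordWalk a e b

    left-balanced : suc a ℕ.≤ ⌈ k /2⌉ → a ℕ.≤ suc (suc e) ℕ.+ b
    left-balanced i≤half =
      subst (a ℕ.≤_) (cong suc (ℕ.+-suc e b))
        (ℕ.≤-pred (ℕ.+-cancelˡ-≤ (suc a) (suc a) (suc (suc e ℕ.+ suc b))
          (subst (suc a ℕ.+ suc a ℕ.≤_) (sym (ℕ.+-suc (suc a) (suc e ℕ.+ suc b)))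
            (ℕ.≤-trans (ℕ.+-mono-≤ i≤half i≤half) (⌈n/2⌉+⌈n/2⌉≤1+n k)))))

    right-balanced : ⌈ k /2⌉ ℕ.< suc B → b ℕ.≤ suc (suc e) ℕ.+ a
    right-balanced half<j =
      ℕ.≤-trans (ℕ.≤-pred b<B) (ℕ.≤-trans (ℕ.≤-reflexive (ℕ.+-comm a (suc e))) (ℕ.n≤1+n (suc e ℕ.+ a)))
      where
      b<B : suc b ℕ.≤ B
      b<B = ℕ.+-cancelˡ-≤ B (suc b) B
              (subst (ℕ._≤ B ℕ.+ B) (sym (ℕ.+-assoc (suc a) (suc e) (suc b)))
                (ℕ.≤-trans (n≤⌈n/2⌉+⌈n/2⌉ k) (ℕ.+-mono-≤ (ℕ.≤-pred half<j) (ℕ.≤-pred half<j))))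

    chord-lowers-kemeny : suc a ℕ.≤ ⌈ k /2⌉ → ⌈ k /2⌉ ℕ.< suc B → ∀ κP κC →
                          IsKemeny (path k) κP → IsKemeny (addEdge (suc A) (suc B) (path k)) κC → κC - κP < 0ℚ
    chord-lowers-kemeny i≤half half<j κP κC path-κ chord-κ =
      *-cancelʳ-<-nonNeg M {{nonNegative 0≤M}} (begin-strict
        (κC - κP) * M                                  ≡⟨ gap ⟩
        - kemeny-gap-poly ⟦ a ⟧ ⟦ e ⟧ ⟦ b ⟧ ⟦ u ⟧ ⟦ v ⟧  <⟨ neg-antimono-< (kemeny-gap-poly-positive a e b u v) ⟩
        0ℚ                                             ≡⟨ sym (*-zeroˡ M) ⟩
        0ℚ * M                                         ∎)
      where
      open ≤-Reasoning
      u v : ℕ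
      u = (suc (suc e) ℕ.+ b) ℕ.∸ a
      v = (suc (suc e) ℕ.+ a) ℕ.∸ b
      M : ℚ
      M = 12 * K * c
      2≤k : 2 ℕ.≤ k
      2≤k = ℕ.≤-trans (s≤s (s≤s z≤n)) (ℕ.<⇒≤ (ℕ.≤-<-trans A+2≤B B<k))
      0≤M : 0ℚ ≤ M
      0≤M = 0≤* (0≤* (nonNegative⁻¹ 12) 0≤⟦ k ⟧) (subst (0ℚ ≤_) (sym c≡) 0≤⟦ suc (suc (suc e)) ⟧)
      ⟦u⟧≡ : ⟦ u ⟧ ≡ ((1ℚ + (1ℚ + ⟦ e ⟧)) + ⟦ b ⟧) - ⟦ a ⟧
      ⟦u⟧≡ = trans (⟦⟧-∸ (left-balanced i≤half)) (cong (_- ⟦ a ⟧) (⟦⟧-+ (suc (suc e)) b))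
      ⟦v⟧≡ : ⟦ v ⟧ ≡ ((1ℚ + (1ℚ + ⟦ e ⟧)) + ⟦ a ⟧) - ⟦ b ⟧
      ⟦v⟧≡ = trans (⟦⟧-∸ (right-balanced half<j)) (cong (_- ⟦ b ⟧) (⟦⟧-+ (suc (suc e)) a))
      gap : (κC - κP) * M ≡ - kemeny-gap-poly ⟦ a ⟧ ⟦ e ⟧ ⟦ b ⟧ ⟦ u ⟧ ⟦ v ⟧
      gap = kemeny-gap ⟦ a ⟧ ⟦ e ⟧ ⟦ b ⟧ β ⟦ km1 ⟧ ⟦ u ⟧ ⟦ v ⟧ κC κP ⟦B⟧≡ ⟦km1⟧≡ ⟦u⟧≡ ⟦v⟧≡
                       (chord-kemeny κC chord-κ) (path-kemeny 2≤k κP path-κ)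

open import Data.Nat using (ℕ; _≤_; _<_; _+_; ⌈_/2⌉)
open import Data.Rational using (ℚ; 0ℚ; _-_) renaming (_<_ to _<ℚ_)
open import Data.Nat using (suc; s≤s; z≤n; _∸_)
open import Data.Nat.Properties using (m+[n∸m]≡n)
import Data.Nat.Tactic.RingSolver as ℕ-Solver
open import Relation.Binary.PropositionalEquality using (_≡_; sym; trans; cong; subst; subst₂)
open KemenyConstants using (module Comparison)

theorem3p2 : (k i j : ℕ) → 3 ≤ k → 1 ≤ i → i < j → j ≤ k → i + 2 ≤ j →
    i ≤ ⌈ k /2⌉ → ⌈ k /2⌉ < j →
    (κP κPij : ℚ) → IsKemeny (path k) κP → IsKemeny (addEdge i j (path k)) κPij →
    (κPij - κP) <ℚ 0ℚ
-- 3 ≤ k and i < j follow from 1 ≤ i and i + 2 ≤ j ≤ k.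
theorem3p2 k (suc a) j _ (s≤s z≤n) _ j≤k i+2≤j i≤half half<j κP κPij path-κ chord-κ =
  Comparison.chord-lowers-kemeny a e b
    (subst (λ n → suc a ≤ ⌈ n /2⌉) k≡ i≤half)
    (subst₂ (λ n m → ⌈ n /2⌉ < m) k≡ j≡ half<j)
    κP κPij
    (subst (λ n → IsKemeny (path n) κP) k≡ path-κ)
    (subst₂ (λ n m → IsKemeny (addEdge (suc a) m (path n)) κPij) k≡ j≡ chord-κ)
  where
  e b : ℕ
  e = j ∸ (suc a + 2)
  b = k ∸ j
  j≡ : j ≡ suc (suc a + suc e)
  j≡ = trans (sym (m+[n∸m]≡n i+2≤j)) (shape a e)
    where
    shape : ∀ a e → suc a + 2 + e ≡ suc (suc a + suc e)
    shape = ℕ-Solver.solve-∀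
  k≡ : k ≡ suc (a + (suc e + suc b))
  k≡ = trans (sym (m+[n∸m]≡n j≤k)) (trans (cong (_+ b) j≡) (shape a e b))
    where
    shape : ∀ a e b → suc (suc a + suc e) + b ≡ suc (a + (suc e + suc b))
    shape = ℕ-Solver.solve-∀
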